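{- Let $F$ be a finite graph with vertex set $V(F)$ and $G$ a finite graph with vertex set $V(G)$, and let $f_1,f_2:V(F)\to\mathbb{Z}_{\ge 0}$ and $g_1,g_2:V(G)\to\mathbb{Z}_{\ge 0}$ be arbitrary functions. Let $T$ be the cycle graph on $n\ge 3$ vertices $t_1,\dots,t_n$ (with edges $t_1t_2, t_2t_3,\dots,t_{n-1}t_n, t_nt_1$), and let $F$, $T$, $G$ be vertex-disjoint. For each integer $i$ with $0\le i\le n-2$ let $H_i$ be the multigraph obtained from the disjoint union $F\sqcup T\sqcup G$ by adding the following edges: (1) for each $v\in V(G)$, $g_1(v)$ edges between $v$ and $t_{n-1}$; (2) for each $v\in V(G)$, $g_2(v)$ edges between $v$ and $t_n$; (3) for each $v\in V(F)$, $f_1(v)$ edges between $v$ and $t_i$ if $1\le i\le n-2$, or between $v$ and $t_n$ if $i=0$; (4) for each $v\in V(F)$, $f_2(v)$ edges between $v$ and $t_{i+1}$. Then the sandpile group $S(H_i)$ does not depend on $i$: $S(H_i)\cong S(H_j)$ for all $0\le i,j\le n-2$.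
   Context: For a finite multigraph $X$ with Laplacian matrix $L$ (diagonal entries the vertex degrees, off-diagonal entry $(u,v)$ equal to minus the number of edges between $u$ and $v$), the sandpile group is $S(X)\cong\bigoplus_{a} C_{|a|}$, where $a$ ranges over the nonzero diagonal entries (with multiplicity) of the Smith normal form of $L$, and $C_m$ denotes the cyclic group of order $m$. -}

module Defs where

open import Data.Nat as ℕ using (ℕ; zero; suc; _≡ᵇ_)
open import Data.Nat.DivMod using (_mod_)
open import Data.Integer as ℤ using (ℤ; +_; -_; ∣_∣)
open import Data.Integer.Divisibility as ℤD using ()
open import Data.Fin as Fin using (Fin; toℕ; splitAt; _≟_)
open import Data.Bool using (Bool; true; false; if_then_else_)
open import Data.Sum using (_⊎_; inj₁; inj₂)
open import Data.Product using (Σ; _×_; _,_; ∃)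
open import Data.Unit using (⊤; tt)
open import Data.Empty using (⊥)
open import Data.List using (List; []; _∷_)
open import Relation.Nullary.Decidable using (does)
open import Relation.Binary.PropositionalEquality using (_≡_)

sumℕ : ∀ {N} → (Fin N → ℕ) → ℕ
sumℕ {zero}  f = 0
sumℕ {suc N} f = f Fin.zero ℕ.+ sumℕ (λ x → f (Fin.suc x))

sumℤ : ∀ {N} → (Fin N → ℤ) → ℤ
sumℤ {zero}  f = + 0
sumℤ {suc N} f = f Fin.zero ℤ.+ sumℤ (λ x → f (Fin.suc x))

Mat : ℕ → Set
Mat N = Fin N → Fin N → ℤ

_⊗_ : ∀ {N} → Mat N → Mat N → Mat N
(A ⊗ B) i j = sumℤ (λ k → A i k ℤ.* B k j)

idMat : ∀ {N} → Mat N
idMat i j = if does (i ≟ j) then + 1 else + 0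

Unimodular : ∀ {N} → Mat N → Set
Unimodular {N} U = Σ (Mat N) λ U' → (∀ i j → (U ⊗ U') i j ≡ idMat i j)
                                   × (∀ i j → (U' ⊗ U) i j ≡ idMat i j)

record IsSNF {N : ℕ} (L D : Mat N) : Set where
  field
    U V      : Mat N
    U-unimod : Unimodular U
    V-unimod : Unimodular V
    eqn      : ∀ i j → ((U ⊗ L) ⊗ V) i j ≡ D i j
    diagonal : ∀ i j → (i ≡ j → ⊥) → D i j ≡ + 0
    divChain : ∀ (a b : Fin N) → toℕ b ≡ suc (toℕ a) → D a a ℤD.∣ D b b

diagList : ∀ {N} → (Fin N → ℕ) → List ℕ
diagList {zero}  f = []
diagList {suc N} f = f Fin.zero ∷ diagList (λ x → f (Fin.suc x))

dropZeros : List ℕ → List ℕ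
dropZeros []            = []
dropZeros (zero ∷ xs)   = dropZeros xs
dropZeros (suc m ∷ xs)  = suc m ∷ dropZeros xs

moduli : ∀ {N} → Mat N → List ℕ
moduli D = dropZeros (diagList (λ k → ∣ D k k ∣))

-- elements of C_{m₁} ⊕ ... ⊕ C_{m_r}
Elem : List ℕ → Set
Elem []       = ⊤
Elem (m ∷ ms) = Fin m × Elem ms

addFin : ∀ {m} → Fin m → Fin m → Fin m
addFin {suc m} a b = (toℕ a ℕ.+ toℕ b) mod suc m

addElem : ∀ {ms} → Elem ms → Elem ms → Elem ms
addElem {[]}     _ _ = tt
addElem {m ∷ ms} (a , x) (b , y) = addFin a b , addElem x y

GroupIso : List ℕ → List ℕ → Set
GroupIso ms ns =
  Σ (Elem ms → Elem ns) λ φ → Σ (Elem ns → Elem ms) λ ψ →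
    (∀ x → ψ (φ x) ≡ x) × (∀ y → φ (ψ y) ≡ y)
    × (∀ x y → φ (addElem x y) ≡ addElem (φ x) (φ y))

-- sandpile group of the multigraph with Laplacian L, computed from an SNF D:
-- S ≅ S' means GroupIso (moduli D) (moduli D').

-- a loopless multigraph on Fin N given by edge multiplicities
laplacian : ∀ {N} → (Fin N → Fin N → ℕ) → Mat N
laplacian {N} μ u v =
  if does (u ≟ v) then + (sumℕ (λ w → if does (u ≟ w) then 0 else μ u w))
                  else - (+ μ u v)

ind : ℕ → ℕ → ℕ
ind x y = if x ≡ᵇ y then 1 else 0

bool→ℕ : Bool → ℕ
bool→ℕ true  = 1
bool→ℕ false = 0

-- Cycle T on n = 3 + k vertices; Fin index c stands for t_{c+1}.
cycMult : ∀ {n} → Fin n → Fin n → ℕ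
cycMult {n} a b with n
... | zero = 0
... | suc n' = ind (toℕ b) (toℕ ((suc (toℕ a)) mod suc n'))
             ℕ.+ ind (toℕ a) (toℕ ((suc (toℕ b)) mod suc n'))

-- index (0-based) of the vertex of T receiving the f₁-edges:
-- t_i if 1 ≤ i, t_n (index n-1 = k+2) if i = 0
f₁target : ℕ → ℕ → ℕ
f₁target k zero    = suc (suc k)
f₁target k (suc i) = i

VH : ℕ → ℕ → ℕ → Set
VH p k q = Fin p ⊎ (Fin (3 ℕ.+ k) ⊎ Fin q)

multS : ∀ {p q} (k : ℕ) (adjF : Fin p → Fin p → Bool) (adjG : Fin q → Fin q → Bool)
        (f₁ f₂ : Fin p → ℕ) (g₁ g₂ : Fin q → ℕ) (i : ℕ) →
        VH p k q → VH p k q → ℕ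
multS k aF aG f₁ f₂ g₁ g₂ i (inj₁ a) (inj₁ b) = bool→ℕ (aF a b)
multS k aF aG f₁ f₂ g₁ g₂ i (inj₂ (inj₂ a)) (inj₂ (inj₂ b)) = bool→ℕ (aG a b)
multS k aF aG f₁ f₂ g₁ g₂ i (inj₂ (inj₁ a)) (inj₂ (inj₁ b)) = cycMult a b
multS k aF aG f₁ f₂ g₁ g₂ i (inj₁ a) (inj₂ (inj₁ c)) =
  f₁ a ℕ.* ind (toℕ c) (f₁target k i) ℕ.+ f₂ a ℕ.* ind (toℕ c) i
multS k aF aG f₁ f₂ g₁ g₂ i (inj₂ (inj₁ c)) (inj₁ a) =
  f₁ a ℕ.* ind (toℕ c) (f₁target k i) ℕ.+ f₂ a ℕ.* ind (toℕ c) i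
multS k aF aG f₁ f₂ g₁ g₂ i (inj₂ (inj₂ a)) (inj₂ (inj₁ c)) =
  g₁ a ℕ.* ind (toℕ c) (suc k) ℕ.+ g₂ a ℕ.* ind (toℕ c) (suc (suc k))
multS k aF aG f₁ f₂ g₁ g₂ i (inj₂ (inj₁ c)) (inj₂ (inj₂ a)) =
  g₁ a ℕ.* ind (toℕ c) (suc k) ℕ.+ g₂ a ℕ.* ind (toℕ c) (suc (suc k))
multS k aF aG f₁ f₂ g₁ g₂ i (inj₁ _) (inj₂ (inj₂ _)) = 0
multS k aF aG f₁ f₂ g₁ g₂ i (inj₂ (inj₂ _)) (inj₁ _) = 0

classify : ∀ p k q → Fin (p ℕ.+ ((3 ℕ.+ k) ℕ.+ q)) → VH p k q
classify p k q u with splitAt p u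
... | inj₁ a = inj₁ a
... | inj₂ w = inj₂ (splitAt (3 ℕ.+ k) w)

H : ∀ {p q} (k : ℕ) (adjF : Fin p → Fin p → Bool) (adjG : Fin q → Fin q → Bool)
    (f₁ f₂ : Fin p → ℕ) (g₁ g₂ : Fin q → ℕ) (i : ℕ) →
    Fin (p ℕ.+ ((3 ℕ.+ k) ℕ.+ q)) → Fin (p ℕ.+ ((3 ℕ.+ k) ℕ.+ q)) → ℕ
H {p} {q} k aF aG f₁ f₂ g₁ g₂ i u v =
  multS k aF aG f₁ f₂ g₁ g₂ i (classify p k q u) (classify p k q v)

module Submission where

-- The sandpile group computed from a Smith normal form D = U L V of the Laplacian L is
-- the torsion part of ℤ^N / Dℤ^N, so we compare lattices: a `LatticeIso` is an additive
-- isomorphism ℤ^I ≅ ℤ^J carrying one sublattice onto another.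
--  (1) If M ∘ B ∘ Q = A with M invertible and Q right-invertible, then A and B span
--      isomorphic lattices (`spanIso`).  In particular L and D do (`snfIso`).
--  (2) A lattice isomorphism ⊕ m_i ℤ ≅ ⊕ m′_i ℤ induces ⊕ C_(m_i) ≅ ⊕ C_(m′_i), the sums
--      running over the nonzero moduli (`cyclicIso`).
--  (3) Passing from H_i to H_(i+1) moves the attachments of F one step along the cycle.
--      With the pivot s = t_(i+1), a row operation R and a change of potentials Z satisfy
--      R ∘ L_(i+1) = L_i ∘ Z vertex by vertex (`Step.key`), so by (1) the Laplacian
--      lattices of all H_i agree (`laplaciansIso`).

module SandpileProof where

  open import Defs
  open import Algebra.Properties.Semiring.Sum as Summation using ()
  open import Data.Nat as ℕ using (ℕ; zero; suc; _≤_)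
  import Data.Nat.Properties as ℕP
  import Data.Nat.DivMod as ℕD
  import Data.Nat.Divisibility as ℕ∣
  open import Data.Integer using (ℤ; +_; -_; _+_; _*_; _-_; 0ℤ; ∣_∣; _%ℕ_)
  import Data.Integer.Properties as ℤP
  import Data.Integer.DivMod as ℤD
  open import Data.Integer.Divisibility.Signed
    using (_∣_; divides; ∣-trans; ∣ᵤ⇒∣; ∣⇒∣ᵤ; ∣m∣n⇒∣m+n; ∣m∣n⇒∣m-n; ∣m⇒∣m*n; ∣m∣∣m; m∣∣m∣)
  open import Data.Integer.Tactic.RingSolver using (solve-∀)
  open import Data.Fin as Fin using (Fin; toℕ; fromℕ; fromℕ<; inject₁; _↑ˡ_; _↑ʳ_; splitAt)
    renaming (zero to fzero; suc to fsuc)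
  import Data.Fin.Properties as FinP
  open import Data.Vec.Functional using (head; tail) renaming (_∷_ to _∷ᵛ_)
  open import Data.List using (_∷_)
  open import Data.Unit using (tt)
  open import Data.Bool using (Bool; if_then_else_)
  open import Data.Sum using (_⊎_; inj₁; inj₂)
  open import Data.Product using (∃; _,_; proj₁; proj₂)
  open import Data.Empty using (⊥; ⊥-elim)
  open import Relation.Nullary using (yes; no)
  open import Relation.Nullary.Decidable using (does)
  open import Relation.Binary.PropositionalEquality
  open import Relation.Binary.Definitions using (tri<; tri≈; tri>)

  open Summation ℤP.+-*-semiring
    using (sum; sum-cong-≗; ∑-distrib-+; ∑-comm; *-distribˡ-sum; *-distribʳ-sum; sum-replicate-zero)

  sumℤ≡sum : ∀ {N} (f : Fin N → ℤ) → sumℤ f ≡ sum f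
  sumℤ≡sum {zero}  f = refl
  sumℤ≡sum {suc N} f = cong (_+_ (f fzero)) (sumℤ≡sum (λ i → f (fsuc i)))

  sumℕ≡sum : ∀ {N} (f : Fin N → ℕ) → + sumℕ f ≡ sum (λ i → + f i)
  sumℕ≡sum {zero}  f = refl
  sumℕ≡sum {suc N} f =
    trans (ℤP.pos-+ (f fzero) _) (cong (_+_ (+ f fzero)) (sumℕ≡sum (λ i → f (fsuc i))))

  sum-zero : ∀ {N} → sum {N} (λ _ → 0ℤ) ≡ 0ℤ
  sum-zero {N} = sum-replicate-zero N

  sum-neg : ∀ {N} (f : Fin N → ℤ) → sum (λ i → - f i) ≡ - sum f
  sum-neg {zero}  f = refl
  sum-neg {suc N} f =
    trans (cong (_+_ (- f fzero)) (sum-neg (λ i → f (fsuc i)))) (sym (ℤP.neg-distrib-+ (f fzero) _))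

  sum-- : ∀ {N} (f g : Fin N → ℤ) → sum (λ i → f i - g i) ≡ sum f - sum g
  sum-- f g = trans (∑-distrib-+ f (λ i → - g i)) (cong (_+_ (sum f)) (sum-neg g))

  sum-delta : ∀ {N} (i : Fin N) (f : Fin N → ℤ) →
    sum (λ j → if does (i Fin.≟ j) then f j else 0ℤ) ≡ f i
  sum-delta {suc N} fzero f = trans (cong (_+_ (f fzero)) (sum-zero {N})) (ℤP.+-identityʳ _)
  sum-delta {suc N} (fsuc i) f =
    trans (ℤP.+-identityˡ _) (trans (sum-cong-≗ shift) (sum-delta i (λ j → f (fsuc j))))
    where
    shift : ∀ j → (if does (fsuc i Fin.≟ fsuc j) then f (fsuc j) else 0ℤ)
                ≡ (if does (i Fin.≟ j) then f (fsuc j) else 0ℤ)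
    shift j with i Fin.≟ j
    ... | yes _ = refl
    ... | no _  = refl

  sum-++ : ∀ p {m} (f : Fin (p ℕ.+ m) → ℤ) →
    sum f ≡ sum (λ a → f (a ↑ˡ m)) + sum (λ b → f (p ↑ʳ b))
  sum-++ zero    f = sym (ℤP.+-identityˡ _)
  sum-++ (suc p) f =
    trans (cong (_+_ (f fzero)) (sum-++ p (λ x → f (fsuc x)))) (sym (ℤP.+-assoc (f fzero) _ _))

  cong₃ : ∀ {A : Set} {x x′ y y′ z z′ : ℤ} (f : ℤ → ℤ → ℤ → A) → x ≡ x′ → y ≡ y′ → z ≡ z′ → f x y z ≡ f x′ y′ z′
  cong₃ f refl refl refl = refl

  ZVec : Set → Set
  ZVec I = I → ℤ

  infixl 6 _⊕_
  infixr 7 _·_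

  _⊕_ : ∀ {I} → ZVec I → ZVec I → ZVec I
  (x ⊕ y) i = x i + y i

  _·_ : ∀ {I} → ℤ → ZVec I → ZVec I
  (c · x) i = c * x i

  record AdditiveIso (I J : Set) : Set where
    field
      to        : ZVec I → ZVec J
      from      : ZVec J → ZVec I
      to-cong   : ∀ {x y} → x ≗ y → to x ≗ to y
      from-cong : ∀ {x y} → x ≗ y → from x ≗ from y
      to-⊕      : ∀ x y → to (x ⊕ y) ≗ to x ⊕ to y
      to-from   : ∀ y → to (from y) ≗ y
      from-to   : ∀ x → from (to x) ≗ x

    -- The inverse of an additive bijection is additive: both sides have the same image under `to`.
    from-⊕ : ∀ x y → from (x ⊕ y) ≗ from x ⊕ from y
    from-⊕ x y i = trans (sym (from-to _ i)) (trans (from-cong same-image i) (from-to _ i))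
      where
      same-image : to (from (x ⊕ y)) ≗ to (from x ⊕ from y)
      same-image j = trans (to-from _ j)
        (sym (trans (to-⊕ (from x) (from y) j) (cong₂ _+_ (to-from x j) (to-from y j))))

    to-− : ∀ x y → to (λ i → x i - y i) ≗ (λ i → to x i - to y i)
    to-− x y i = begin
      to (λ j → x j - y j) i                       ≡⟨ add-sub (to (λ j → x j - y j) i) (to y i) ⟩
      (to (λ j → x j - y j) i + to y i) - to y i   ≡⟨ cong (_- to y i) (sym (to-⊕ _ y i)) ⟩
      to (λ j → (x j - y j) + y j) i - to y i      ≡⟨ cong (_- to y i) (to-cong (λ j → sub-add (x j) (y j)) i) ⟩
      to x i - to y i                              ∎
      where
      open ≡-Reasoning
      add-sub : ∀ (a b : ℤ) → a ≡ (a + b) - b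
      add-sub = solve-∀
      sub-add : ∀ (a b : ℤ) → (a - b) + b ≡ a
      sub-add = solve-∀

    to-· : ∀ n x → to ((+ n) · x) ≗ ((+ n) · to x)
    to-· zero x i = begin
      to ((+ 0) · x) i          ≡⟨ to-cong (λ j → trans (ℤP.*-zeroˡ (x j)) (sym (ℤP.+-inverseʳ (x j)))) i ⟩
      to (λ j → x j - x j) i    ≡⟨ to-− x x i ⟩
      to x i - to x i           ≡⟨ trans (ℤP.+-inverseʳ (to x i)) (sym (ℤP.*-zeroˡ (to x i))) ⟩
      + 0 * to x i              ∎
      where open ≡-Reasoning
    to-· (suc n) x i = begin
      to ((+ suc n) · x) i      ≡⟨ to-cong (λ j → succ-scale n (x j)) i ⟩
      to (x ⊕ ((+ n) · x)) i    ≡⟨ to-⊕ x ((+ n) · x) i ⟩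
      to x i + to ((+ n) · x) i ≡⟨ cong (_+_ (to x i)) (to-· n x i) ⟩
      to x i + + n * to x i     ≡⟨ sym (succ-scale n (to x i)) ⟩
      + suc n * to x i          ∎
      where
      open ≡-Reasoning
      succ-scale : ∀ n a → + suc n * a ≡ a + + n * a
      succ-scale n a = trans (cong (_* a) (ℤP.pos-+ 1 n)) (distrib (+ n) a)
        where distrib : ∀ (m a : ℤ) → (+ 1 + m) * a ≡ a + m * a
              distrib = solve-∀

  AdditiveIso-sym : ∀ {I J} → AdditiveIso I J → AdditiveIso J I
  AdditiveIso-sym e = record
    { to = from ; from = to ; to-cong = from-cong ; from-cong = to-cong
    ; to-⊕ = from-⊕ ; to-from = from-to ; from-to = to-from }
    where open AdditiveIso e

  AdditiveIso-trans : ∀ {I J K} → AdditiveIso I J → AdditiveIso J K → AdditiveIso I K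
  AdditiveIso-trans e f = record
    { to = λ x → F.to (E.to x) ; from = λ z → E.from (F.from z)
    ; to-cong = λ p → F.to-cong (E.to-cong p) ; from-cong = λ p → E.from-cong (F.from-cong p)
    ; to-⊕ = λ x y i → trans (F.to-cong (E.to-⊕ x y) i) (F.to-⊕ (E.to x) (E.to y) i)
    ; to-from = λ z i → trans (F.to-cong (E.to-from (F.from z)) i) (F.to-from z i)
    ; from-to = λ x i → trans (E.from-cong (F.from-to (E.to x)) i) (E.from-to x i) }
    where module E = AdditiveIso e
          module F = AdditiveIso f

  reindex : ∀ {I J} (g : I → J) (h : J → I) → (∀ j → g (h j) ≡ j) → (∀ i → h (g i) ≡ i) →
            AdditiveIso J I
  reindex g h gh hg = record
    { to = λ y i → y (g i) ; from = λ x j → x (h j)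
    ; to-cong = λ p i → p (g i) ; from-cong = λ p j → p (h j)
    ; to-⊕ = λ x y i → refl
    ; to-from = λ x i → cong x (hg i) ; from-to = λ y j → cong y (gh j) }

  record LatticeIso {I J} (P : ZVec I → Set) (Q : ZVec J → Set) : Set where
    field
      iso    : AdditiveIso I J
    open AdditiveIso iso public
    field
      to-∈   : ∀ x → P x → Q (to x)
      from-∈ : ∀ y → Q y → P (from y)

  LatticeIso-refl : ∀ {I} {P : ZVec I → Set} → LatticeIso P P
  LatticeIso-refl = record
    { iso = record { to = λ x → x ; from = λ x → x ; to-cong = λ p → p ; from-cong = λ p → p
                   ; to-⊕ = λ _ _ _ → refl ; to-from = λ _ _ → refl ; from-to = λ _ _ → refl }
    ; to-∈ = λ _ p → p ; from-∈ = λ _ p → p }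

  LatticeIso-sym : ∀ {I J} {P : ZVec I → Set} {Q : ZVec J → Set} → LatticeIso P Q → LatticeIso Q P
  LatticeIso-sym e = record { iso = AdditiveIso-sym iso ; to-∈ = from-∈ ; from-∈ = to-∈ }
    where open LatticeIso e

  LatticeIso-trans : ∀ {I J K} {P : ZVec I → Set} {Q : ZVec J → Set} {R : ZVec K → Set} →
                     LatticeIso P Q → LatticeIso Q R → LatticeIso P R
  LatticeIso-trans e f = record
    { iso = AdditiveIso-trans E.iso F.iso
    ; to-∈ = λ x p → F.to-∈ _ (E.to-∈ x p) ; from-∈ = λ z r → E.from-∈ _ (F.from-∈ z r) }
    where module E = LatticeIso e
          module F = LatticeIso f

  LatticeIso-resp : ∀ {I J} {P P' : ZVec I → Set} {Q Q' : ZVec J → Set} →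
    (∀ x → P x → P' x) → (∀ x → P' x → P x) → (∀ y → Q y → Q' y) → (∀ y → Q' y → Q y) →
    LatticeIso P Q → LatticeIso P' Q'
  LatticeIso-resp P⇒P' P'⇒P Q⇒Q' Q'⇒Q e = record
    { iso = iso
    ; to-∈ = λ x p → Q⇒Q' _ (to-∈ x (P'⇒P x p)) ; from-∈ = λ y q → P⇒P' _ (from-∈ y (Q'⇒Q y q)) }
    where open LatticeIso e

  Span : ∀ {K I} → (ZVec K → ZVec I) → ZVec I → Set
  Span A x = ∃ λ z → x ≗ A z

  spanIso : ∀ {I J K L} (M : AdditiveIso J I)
    (A : ZVec K → ZVec I) (B : ZVec L → ZVec J) (Q : ZVec K → ZVec L) (Q⁻ : ZVec L → ZVec K) →
    (∀ {x y} → x ≗ y → B x ≗ B y) → (∀ w → Q (Q⁻ w) ≗ w) →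
    (∀ z → AdditiveIso.to M (B (Q z)) ≗ A z) →
    LatticeIso (Span A) (Span B)
  spanIso M A B Q Q⁻ B-cong QQ⁻ MBQ≗A = record
    { iso = AdditiveIso-sym M
    ; to-∈ = λ x (z , x≗Az) → Q z , λ j →
        trans (from-cong (λ i → trans (x≗Az i) (sym (MBQ≗A z i))) j) (from-to (B (Q z)) j)
    ; from-∈ = λ y (w , y≗Bw) → Q⁻ w , λ i →
        trans (to-cong (λ j → trans (y≗Bw j) (sym (B-cong (QQ⁻ w) j))) i) (MBQ≗A (Q⁻ w) i) }
    where open AdditiveIso M

  _▷_ : ∀ {N} → Mat N → ZVec (Fin N) → ZVec (Fin N)
  (A ▷ x) i = sum (λ k → A i k * x k)

  ▷-cong : ∀ {N} (A : Mat N) {x y : ZVec (Fin N)} → x ≗ y → A ▷ x ≗ A ▷ y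
  ▷-cong A x≗y i = sum-cong-≗ (λ k → cong (A i k *_) (x≗y k))

  ▷-entries : ∀ {N} {A B : Mat N} → (∀ i j → A i j ≡ B i j) → ∀ x → A ▷ x ≗ B ▷ x
  ▷-entries A≡B x i = sum-cong-≗ (λ k → cong (_* x k) (A≡B i k))

  ▷-⊕ : ∀ {N} (A : Mat N) x y → A ▷ (x ⊕ y) ≗ (A ▷ x) ⊕ (A ▷ y)
  ▷-⊕ A x y i =
    trans (sum-cong-≗ (λ k → ℤP.*-distribˡ-+ (A i k) (x k) (y k))) (∑-distrib-+ (λ k → A i k * x k) (λ k → A i k * y k))

  ▷-⊗ : ∀ {N} (A B : Mat N) x → (A ⊗ B) ▷ x ≗ A ▷ (B ▷ x)
  ▷-⊗ A B x i = begin
    sum (λ k → sumℤ (λ l → A i l * B l k) * x k)     ≡⟨ sum-cong-≗ (λ k → cong (_* x k) (sumℤ≡sum (λ l → A i l * B l k))) ⟩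
    sum (λ k → sum (λ l → A i l * B l k) * x k)      ≡⟨ sum-cong-≗ (λ k → *-distribʳ-sum (x k) (λ l → A i l * B l k)) ⟩
    sum (λ k → sum (λ l → A i l * B l k * x k))      ≡⟨ ∑-comm (λ k l → A i l * B l k * x k) ⟩
    sum (λ l → sum (λ k → A i l * B l k * x k))
      ≡⟨ sum-cong-≗ (λ l → trans (sum-cong-≗ (λ k → ℤP.*-assoc (A i l) (B l k) (x k)))
                                 (sym (*-distribˡ-sum (A i l) (λ k → B l k * x k)))) ⟩
    sum (λ l → A i l * sum (λ k → B l k * x k))      ∎
    where open ≡-Reasoning

  ▷-diagonal : ∀ {N} (D : Mat N) → (∀ i j → (i ≡ j → ⊥) → D i j ≡ + 0) →
               ∀ z i → (D ▷ z) i ≡ D i i * z i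
  ▷-diagonal D diagonal z i = trans (sum-cong-≗ only-diagonal) (sum-delta i (λ k → D i k * z k))
    where
    only-diagonal : ∀ k → D i k * z k ≡ (if does (i Fin.≟ k) then D i k * z k else 0ℤ)
    only-diagonal k with i Fin.≟ k
    ... | yes _  = refl
    ... | no i≢k = trans (cong (_* z k) (diagonal i k i≢k)) (ℤP.*-zeroˡ (z k))

  ▷-idMat : ∀ {N} x → idMat {N} ▷ x ≗ x
  ▷-idMat x i = trans (▷-diagonal idMat off-diagonal x i) (trans (cong (_* x i) (one i)) (ℤP.*-identityˡ (x i)))
    where
    off-diagonal : ∀ i j → (i ≡ j → ⊥) → idMat i j ≡ + 0
    off-diagonal i j i≢j with i Fin.≟ j
    ... | yes i≡j = ⊥-elim (i≢j i≡j)
    ... | no _    = refl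
    one : ∀ i → idMat i i ≡ + 1
    one i with i Fin.≟ i
    ... | yes _   = refl
    ... | no i≢i  = ⊥-elim (i≢i refl)

  ▷-inverse : ∀ {N} (A B : Mat N) → (∀ i j → (A ⊗ B) i j ≡ idMat i j) → ∀ y → A ▷ (B ▷ y) ≗ y
  ▷-inverse A B AB≡I y i = trans (sym (▷-⊗ A B y i)) (trans (▷-entries AB≡I y i) (▷-idMat y i))

  unimodularIso : ∀ {N} (U : Mat N) → Unimodular U → AdditiveIso (Fin N) (Fin N)
  unimodularIso U (U⁻ , UU⁻ , U⁻U) = record
    { to = U ▷_ ; from = U⁻ ▷_ ; to-cong = ▷-cong U ; from-cong = ▷-cong U⁻ ; to-⊕ = ▷-⊕ U
    ; to-from = ▷-inverse U U⁻ UU⁻ ; from-to = ▷-inverse U⁻ U U⁻U }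

  snfIso : ∀ {N} {L D : Mat N} → IsSNF L D → LatticeIso (Span (D ▷_)) (Span (L ▷_))
  snfIso {L = L} {D} S =
    spanIso (unimodularIso U U-unimod) (D ▷_) (L ▷_) (V ▷_) (proj₁ V-unimod ▷_) (▷-cong L)
      (▷-inverse V (proj₁ V-unimod) (proj₁ (proj₂ V-unimod)))
      (λ z i → trans (sym (trans (▷-⊗ (U ⊗ L) V z i) (▷-⊗ U L (V ▷ z) i))) (▷-entries eqn z i))
    where open IsSNF S

  DiagLattice : ∀ {N} → (Fin N → ℕ) → ZVec (Fin N) → Set
  DiagLattice m x = ∀ i → + m i ∣ x i

  module _ {N} (D : Mat N) (diagonal : ∀ i j → (i ≡ j → ⊥) → D i j ≡ + 0) where

    diagonalSpan⇒ : ∀ x → Span (D ▷_) x → DiagLattice (λ i → ∣ D i i ∣) x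
    diagonalSpan⇒ x (z , x≗Dz) i =
      ∣-trans ∣m∣∣m (divides (z i) (trans (x≗Dz i) (trans (▷-diagonal D diagonal z i) (ℤP.*-comm (D i i) (z i)))))

    diagonalSpan⇐ : ∀ x → DiagLattice (λ i → ∣ D i i ∣) x → Span (D ▷_) x
    diagonalSpan⇐ x m∣x = (λ i → _∣_.quotient (Dii∣x i)) , λ i →
      trans (_∣_.equality (Dii∣x i)) (trans (ℤP.*-comm _ (D i i)) (sym (▷-diagonal D diagonal _ i)))
      where
      Dii∣x : ∀ i → D i i ∣ x i
      Dii∣x i = ∣-trans m∣∣m∣ (m∣x i)

  -- Residues.  `residue x k ∈ {0..k}` is the canonical representative of x modulo k+1.

  residue : ℤ → ℕ → ℕ
  residue x k = x %ℕ suc k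

  residueFin : ℤ → (k : ℕ) → Fin (suc k)
  residueFin x k = fromℕ< (ℤD.n%ℕd<d x (suc k))

  toℕ-residueFin : ∀ x k → toℕ (residueFin x k) ≡ residue x k
  toℕ-residueFin x k = FinP.toℕ-fromℕ< (ℤD.n%ℕd<d x (suc k))

  residue-∣ : ∀ x k → + suc k ∣ x - + residue x k
  residue-∣ x k = divides (x ℤD./ℕ suc k) (begin
    x - + r                         ≡⟨ cong (_- + r) (ℤD.a≡a%ℕn+[a/ℕn]*n x (suc k)) ⟩
    (+ r + q * + suc k) - + r       ≡⟨ cancel (+ r) (q * + suc k) ⟩
    q * + suc k                     ∎)
    where
    open ≡-Reasoning
    r = residue x k
    q = x ℤD./ℕ suc k
    cancel : ∀ (a b : ℤ) → (a + b) - a ≡ b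
    cancel = solve-∀

  residue-unique : ∀ {d r s} → r ℕ.< d → s ℕ.< d → + d ∣ + r - + s → r ≡ s
  residue-unique {d} {r} {s} r<d s<d d∣r-s = ℤP.+-injective (ℤP.i-j≡0⇒i≡j (+ r) (+ s) (ℤP.∣i∣≡0⇒i≡0 distance≡0))
    where
    distance<d : ∣ + r - + s ∣ ℕ.< d
    distance<d = ℕP.≤-<-trans (ℕP.≤-reflexive (cong ∣_∣ (ℤP.m-n≡m⊖n r s)))
                   (ℕP.≤-<-trans (ℤP.∣m⊝n∣≤m⊔n r s) (ℕP.⊔-lub r<d s<d))
    distance≡0 : ∣ + r - + s ∣ ≡ 0
    distance≡0 with ∣ + r - + s ∣ in eq
    ... | zero  = refl
    ... | suc _ = ⊥-elim (ℕ∣.>⇒∤ (subst (ℕ._< d) eq distance<d) (subst (d ℕ∣.∣_) eq (∣⇒∣ᵤ d∣r-s)))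

  residue-char : ∀ x k r → r ℕ.< suc k → + suc k ∣ x - + r → residue x k ≡ r
  residue-char x k r r<d d∣x-r =
    residue-unique (ℤD.n%ℕd<d x (suc k)) r<d
      (subst (+ suc k ∣_) (difference x (+ r) (+ residue x k)) (∣m∣n⇒∣m-n d∣x-r (residue-∣ x k)))
    where
    difference : ∀ (x r s : ℤ) → (x - r) - (x - s) ≡ s - r
    difference = solve-∀

  residue-cong : ∀ k x y → + suc k ∣ x - y → residue x k ≡ residue y k
  residue-cong k x y d∣x-y =
    residue-char x k (residue y k) (ℤD.n%ℕd<d y (suc k))
      (subst (+ suc k ∣_) (telescope x y (+ residue y k)) (∣m∣n⇒∣m+n d∣x-y (residue-∣ y k)))
    where
    telescope : ∀ (x y s : ℤ) → (x - y) + (y - s) ≡ x - s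
    telescope = solve-∀

  residue-small : ∀ k r → r ℕ.< suc k → residue (+ r) k ≡ r
  residue-small k r r<d = residue-char (+ r) k r r<d (divides 0ℤ (ℤP.+-inverseʳ (+ r)))

  Congruent : ∀ {N} → (Fin N → ℕ) → ZVec (Fin N) → ZVec (Fin N) → Set
  Congruent m x y = DiagLattice m (λ i → x i - y i)

  Torsion : ∀ {N} → (Fin N → ℕ) → ZVec (Fin N) → Set
  Torsion m x = ∀ i → m i ≡ 0 → x i ≡ 0ℤ

  ≗⇒Congruent : ∀ {N} (m : Fin N → ℕ) {x y} → x ≗ y → Congruent m x y
  ≗⇒Congruent m {x} x≗y i = divides 0ℤ (trans (cong (_-_ (x i)) (sym (x≗y i))) (ℤP.+-inverseʳ (x i)))

  DiagLattice-resp : ∀ {N} (m : Fin N → ℕ) {x y} → x ≗ y → DiagLattice m x → DiagLattice m y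
  DiagLattice-resp m x≗y m∣x i = subst (+ m i ∣_) (x≗y i) (m∣x i)

  -- The group ⊕ C_(m_i) over the nonzero m_i, i.e. the torsion part of ℤ^N / ⊕ m_i ℤ.
  Cyclics : ∀ {N} → (Fin N → ℕ) → Set
  Cyclics m = Elem (dropZeros (diagList m))

  embedHead : ∀ {N} (h : ℕ) (m : Fin N → ℕ) → Elem (dropZeros (h ∷ diagList m)) → ZVec (Fin (suc N))
  embed     : ∀ {N} (m : Fin N → ℕ) → Cyclics m → ZVec (Fin N)
  embedHead zero    m x       = 0ℤ ∷ᵛ embed m x
  embedHead (suc k) m (a , x) = + toℕ a ∷ᵛ embed m x
  embed {zero}  m x = λ ()
  embed {suc N} m x = embedHead (head m) (tail m) x

  reduceHead : ∀ {N} (h : ℕ) (m : Fin N → ℕ) → ZVec (Fin (suc N)) → Elem (dropZeros (h ∷ diagList m))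
  reduce     : ∀ {N} (m : Fin N → ℕ) → ZVec (Fin N) → Cyclics m
  reduceHead zero    m u = reduce m (tail u)
  reduceHead (suc k) m u = residueFin (head u) k , reduce m (tail u)
  reduce {zero}  m u = tt
  reduce {suc N} m u = reduceHead (head m) (tail m) u

  reduce-embed : ∀ {N} (m : Fin N → ℕ) x → reduce m (embed m x) ≡ x
  reduce-embed {zero}  m tt = refl
  reduce-embed {suc N} m x with m fzero
  ... | zero  = reduce-embed (tail m) x
  ... | suc k = cong₂ _,_ (FinP.toℕ-injective (trans (toℕ-residueFin (+ toℕ (proj₁ x)) k) (residue-small k (toℕ (proj₁ x)) (FinP.toℕ<n (proj₁ x)))))
                          (reduce-embed (tail m) (proj₂ x))

  reduce-cong : ∀ {N} (m : Fin N → ℕ) {u v} → Congruent m u v → reduce m u ≡ reduce m v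
  reduce-cong {zero}  m u≡v = refl
  reduce-cong {suc N} m {u} {v} u≡v with m fzero | u≡v fzero
  ... | zero  | _     = reduce-cong (tail m) (λ i → u≡v (fsuc i))
  ... | suc k | d∣u-v = cong₂ _,_
    (FinP.toℕ-injective (trans (toℕ-residueFin (head u) k) (trans (residue-cong k (head u) (head v) d∣u-v) (sym (toℕ-residueFin (head v) k)))))
    (reduce-cong (tail m) (λ i → u≡v (fsuc i)))

  embed-torsion : ∀ {N} (m : Fin N → ℕ) x → Torsion m (embed m x)
  embed-torsion {suc N} m x fzero with m fzero
  ... | zero  = λ _ → refl
  ... | suc k = λ ()
  embed-torsion {suc N} m x (fsuc i) with m fzero
  ... | zero  = embed-torsion (tail m) x i
  ... | suc k = embed-torsion (tail m) (proj₂ x) i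

  embed-reduce : ∀ {N} (m : Fin N → ℕ) u → Torsion m u → Congruent m (embed m (reduce m u)) u
  embed-reduce {suc N} m u tor fzero with m fzero | tor fzero
  ... | zero  | u₀≡0 = divides 0ℤ (cong (_-_ 0ℤ) (u₀≡0 refl))
  ... | suc k | _    =
    subst (λ r → + suc k ∣ + r - head u) (sym (toℕ-residueFin (head u) k)) (flip {x = head u} (residue-∣ (head u) k))
    where
    flip : ∀ {d x y} → d ∣ x - y → d ∣ y - x
    flip {d} {x} {y} (divides q eq) = divides (- q) (trans (negate x y) (trans (cong -_ eq) (ℤP.neg-distribˡ-* q d)))
      where negate : ∀ (x y : ℤ) → y - x ≡ - (x - y)
            negate = solve-∀
  embed-reduce {suc N} m u tor (fsuc i) with m fzero
  ... | zero  = embed-reduce (tail m) (tail u) (λ j → tor (fsuc j)) i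
  ... | suc k = embed-reduce (tail m) (tail u) (λ j → tor (fsuc j)) i

  reduce-⊕ : ∀ {N} (m : Fin N → ℕ) u v → reduce m (u ⊕ v) ≡ addElem (reduce m u) (reduce m v)
  reduce-⊕ {zero}  m u v = refl
  reduce-⊕ {suc N} m u v with m fzero
  ... | zero  = reduce-⊕ (tail m) (tail u) (tail v)
  ... | suc k = cong₂ _,_ (FinP.toℕ-injective (begin
      toℕ (residueFin (u₀ + v₀) k)      ≡⟨ toℕ-residueFin (u₀ + v₀) k ⟩
      residue (u₀ + v₀) k               ≡⟨ residue-cong k (u₀ + v₀) (+ ru + + rv) (subst (+ suc k ∣_) (regroup u₀ v₀ (+ ru) (+ rv)) (∣m∣n⇒∣m+n (reps u₀) (reps v₀))) ⟩
      residue (+ ru + + rv) k           ≡⟨ cong (λ z → residue z k) (sym (ℤP.pos-+ ru rv)) ⟩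
      (ru ℕ.+ rv) ℕ.% suc k             ≡⟨ sym (FinP.toℕ-fromℕ< _) ⟩
      toℕ (addFin (residueFin u₀ k) (residueFin v₀ k)) ∎))
    (reduce-⊕ (tail m) (tail u) (tail v))
    where
    open ≡-Reasoning
    u₀ = head u
    v₀ = head v
    ru = toℕ (residueFin u₀ k)
    rv = toℕ (residueFin v₀ k)
    reps : ∀ x → + suc k ∣ x - + toℕ (residueFin x k)
    reps x = subst (λ r → + suc k ∣ x - + r) (sym (toℕ-residueFin x k)) (residue-∣ x k)
    regroup : ∀ (u v a b : ℤ) → (u - a) + (v - b) ≡ (u + v) - (a + b)
    regroup = solve-∀

  -- The product of the nonzero moduli: a nonzero common multiple of all of them.
  orOne : ℕ → ℕ
  orOne zero    = 1
  orOne (suc k) = suc k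

  nonzeroProduct : ∀ {N} → (Fin N → ℕ) → ℕ
  nonzeroProduct {zero}  m = 1
  nonzeroProduct {suc N} m = orOne (head m) ℕ.* nonzeroProduct (tail m)

  nonzeroProduct-nonZero : ∀ {N} (m : Fin N → ℕ) → ℕ.NonZero (nonzeroProduct m)
  nonzeroProduct-nonZero {zero}  m = _
  nonzeroProduct-nonZero {suc N} m =
    ℕP.m*n≢0 (orOne (head m)) (nonzeroProduct (tail m)) {{orOne-nonZero (head m)}} {{nonzeroProduct-nonZero (tail m)}}
    where
    orOne-nonZero : ∀ h → ℕ.NonZero (orOne h)
    orOne-nonZero zero    = _
    orOne-nonZero (suc k) = _

  ∣nonzeroProduct : ∀ {N} (m : Fin N → ℕ) i → m i ≡ 0 ⊎ m i ℕ∣.∣ nonzeroProduct m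
  ∣nonzeroProduct {suc N} m fzero with m fzero
  ... | zero  = inj₁ refl
  ... | suc k = inj₂ (ℕ∣.m∣m*n (nonzeroProduct (tail m)))
  ∣nonzeroProduct {suc N} m (fsuc i) with ∣nonzeroProduct (tail m) i
  ... | inj₁ mᵢ≡0 = inj₁ mᵢ≡0
  ... | inj₂ mᵢ∣c = inj₂ (ℕ∣.∣n⇒∣m*n (orOne (m fzero)) mᵢ∣c)

  -- Torsion vectors are those with a nonzero multiple in the lattice; for the torsion
  -- vectors of ⊕ m_i ℤ the multiple can be taken to be `nonzeroProduct m`.
  torsion⇒scaled∈ : ∀ {N} (m : Fin N → ℕ) u → Torsion m u → DiagLattice m (+ nonzeroProduct m · u)
  torsion⇒scaled∈ m u tor i with ∣nonzeroProduct m i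
  ... | inj₁ mᵢ≡0 = divides 0ℤ (trans (cong (_*_ (+ nonzeroProduct m)) (tor i mᵢ≡0)) (ℤP.*-zeroʳ (+ nonzeroProduct m)))
  ... | inj₂ mᵢ∣c = ∣m⇒∣m*n {i = + m i} {m = + nonzeroProduct m} (u i) (∣ᵤ⇒∣ mᵢ∣c)

  scaled∈⇒torsion : ∀ {N} (m : Fin N → ℕ) (c : ℕ) .{{_ : ℕ.NonZero c}} u → DiagLattice m (+ c · u) → Torsion m u
  scaled∈⇒torsion m c u m∣cu i mᵢ≡0 = ℤP.*-cancelˡ-≡ (+ c) (u i) 0ℤ (begin
    + c * u i    ≡⟨ _∣_.equality (m∣cu i) ⟩
    q * + m i    ≡⟨ cong (λ z → q * + z) mᵢ≡0 ⟩
    q * 0ℤ       ≡⟨ ℤP.*-zeroʳ q ⟩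
    0ℤ           ≡⟨ sym (ℤP.*-zeroʳ (+ c)) ⟩
    + c * 0ℤ     ∎)
    where
    open ≡-Reasoning
    q = _∣_.quotient (m∣cu i)

  module _ {N N'} {m : Fin N → ℕ} {m' : Fin N' → ℕ} (e : LatticeIso (DiagLattice m) (DiagLattice m')) where
    open LatticeIso e

    to-congruent : ∀ u v → Congruent m u v → Congruent m' (to u) (to v)
    to-congruent u v u≡v = DiagLattice-resp m' (to-− u v) (to-∈ _ u≡v)

    to-torsion : ∀ u → Torsion m u → Torsion m' (to u)
    to-torsion u tor = scaled∈⇒torsion m' (nonzeroProduct m) {{nonzeroProduct-nonZero m}} (to u)
      (DiagLattice-resp m' (to-· (nonzeroProduct m) u) (to-∈ _ (torsion⇒scaled∈ m u tor)))

    induced : Cyclics m → Cyclics m'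
    induced x = reduce m' (to (embed m x))

    induced-⊕ : ∀ x y → induced (addElem x y) ≡ addElem (induced x) (induced y)
    induced-⊕ x y = begin
      reduce m' (to (embed m (addElem x y)))     ≡⟨ reduce-cong m' (to-congruent _ _ sum-representative) ⟩
      reduce m' (to (embed m x ⊕ embed m y))     ≡⟨ reduce-cong m' (≗⇒Congruent m' (to-⊕ (embed m x) (embed m y))) ⟩
      reduce m' (to (embed m x) ⊕ to (embed m y)) ≡⟨ reduce-⊕ m' _ _ ⟩
      addElem (induced x) (induced y)            ∎
      where
      open ≡-Reasoning
      s = embed m x ⊕ embed m y
      reduce-s : reduce m s ≡ addElem x y
      reduce-s = trans (reduce-⊕ m _ _) (cong₂ addElem (reduce-embed m x) (reduce-embed m y))
      sum-representative : Congruent m (embed m (addElem x y)) s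
      sum-representative = subst (λ z → Congruent m (embed m z) s) reduce-s
        (embed-reduce m s (λ i mᵢ≡0 → cong₂ _+_ (embed-torsion m x i mᵢ≡0) (embed-torsion m y i mᵢ≡0)))

  induced-inverse : ∀ {N N'} {m : Fin N → ℕ} {m' : Fin N' → ℕ} (e : LatticeIso (DiagLattice m) (DiagLattice m')) →
    ∀ x → induced (LatticeIso-sym e) (induced e x) ≡ x
  induced-inverse {m = m} {m'} e x = begin
    reduce m (from (embed m' (reduce m' v)))   ≡⟨ reduce-cong m (to-congruent (LatticeIso-sym e) _ _ (embed-reduce m' v (to-torsion e _ (embed-torsion m x)))) ⟩
    reduce m (from v)                          ≡⟨ reduce-cong m (≗⇒Congruent m (from-to (embed m x))) ⟩
    reduce m (embed m x)                       ≡⟨ reduce-embed m x ⟩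
    x                                          ∎
    where
    open ≡-Reasoning
    open LatticeIso e
    v = to (embed m x)

  cyclicIso : ∀ {N N'} {m : Fin N → ℕ} {m' : Fin N' → ℕ} → LatticeIso (DiagLattice m) (DiagLattice m') →
              GroupIso (dropZeros (diagList m)) (dropZeros (diagList m'))
  cyclicIso e = induced e , induced (LatticeIso-sym e) , induced-inverse e
              , induced-inverse (LatticeIso-sym e) , induced-⊕ e

  laplacian-▷ : ∀ {N} (μ : Fin N → Fin N → ℕ) y u →
    (laplacian μ ▷ y) u ≡ sum (λ w → + μ u w * (y u - y w))
  laplacian-▷ μ y u = begin
    sum (λ v → laplacian μ u v * y v)
      ≡⟨ sum-cong-≗ split-entry ⟩
    sum (λ v → (if does (u Fin.≟ v) then + degree * y v else 0ℤ) - + ν v * y v)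
      ≡⟨ sum-- _ (λ v → + ν v * y v) ⟩
    sum (λ v → if does (u Fin.≟ v) then + degree * y v else 0ℤ) - sum (λ v → + ν v * y v)
      ≡⟨ cong (_- sum (λ v → + ν v * y v)) (sum-delta u (λ v → + degree * y v)) ⟩
    + degree * y u - sum (λ v → + ν v * y v)
      ≡⟨ cong (λ d → d * y u - sum (λ v → + ν v * y v)) (sumℕ≡sum ν) ⟩
    sum (λ v → + ν v) * y u - sum (λ v → + ν v * y v)
      ≡⟨ cong (_- sum (λ v → + ν v * y v)) (*-distribʳ-sum (y u) (λ v → + ν v)) ⟩
    sum (λ v → + ν v * y u) - sum (λ v → + ν v * y v)
      ≡⟨ sym (sum-- (λ v → + ν v * y u) (λ v → + ν v * y v)) ⟩
    sum (λ v → + ν v * y u - + ν v * y v)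
      ≡⟨ sum-cong-≗ loops-vanish ⟩
    sum (λ w → + μ u w * (y u - y w)) ∎
    where
    open ≡-Reasoning
    ν : Fin _ → ℕ
    ν w = if does (u Fin.≟ w) then 0 else μ u w
    degree = sumℕ ν
    split-entry : ∀ v → laplacian μ u v * y v ≡ (if does (u Fin.≟ v) then + degree * y v else 0ℤ) - + ν v * y v
    split-entry v with u Fin.≟ v
    ... | yes _ = sym (trans (cong (_-_ (+ degree * y v)) (ℤP.*-zeroˡ (y v))) (ℤP.+-identityʳ _))
    ... | no _  = trans (sym (ℤP.neg-distribˡ-* (+ μ u v) (y v))) (sym (ℤP.+-identityˡ _))
    loops-vanish : ∀ v → + ν v * y u - + ν v * y v ≡ + μ u v * (y u - y v)
    loops-vanish v with u Fin.≟ v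
    ... | yes refl = trans (ℤP.+-inverseʳ (0ℤ * y u)) (sym (trans (cong (_*_ (+ μ u u)) (ℤP.+-inverseʳ (y u))) (ℤP.*-zeroʳ (+ μ u u))))
    ... | no _     = distrib (+ μ u v) (y u) (y v)
      where distrib : ∀ (m a b : ℤ) → m * a - m * b ≡ m * (a - b)
            distrib = solve-∀

  module Vertices (p k q : ℕ) where

    n : ℕ
    n = 3 ℕ.+ k

    V : Set
    V = VH p k q

    NV : ℕ
    NV = p ℕ.+ (n ℕ.+ q)

    index : V → Fin NV
    index (inj₁ a)        = a ↑ˡ (n ℕ.+ q)
    index (inj₂ (inj₁ c)) = p ↑ʳ (c ↑ˡ q)
    index (inj₂ (inj₂ b)) = p ↑ʳ (n ↑ʳ b)

    classify-index : ∀ v → classify p k q (index v) ≡ v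
    classify-index (inj₁ a)
      rewrite FinP.splitAt-↑ˡ p a (n ℕ.+ q) = refl
    classify-index (inj₂ (inj₁ c))
      rewrite FinP.splitAt-↑ʳ p (n ℕ.+ q) (c ↑ˡ q) | FinP.splitAt-↑ˡ n c q = refl
    classify-index (inj₂ (inj₂ b))
      rewrite FinP.splitAt-↑ʳ p (n ℕ.+ q) (n ↑ʳ b) | FinP.splitAt-↑ʳ n q b = refl

    index-classify : ∀ u → index (classify p k q u) ≡ u
    index-classify u with splitAt p u in eq
    ... | inj₁ a = FinP.splitAt⁻¹-↑ˡ eq
    ... | inj₂ w with splitAt n w in eq′
    ...   | inj₁ c = trans (cong (p ↑ʳ_) (FinP.splitAt⁻¹-↑ˡ eq′)) (FinP.splitAt⁻¹-↑ʳ eq)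
    ...   | inj₂ b = trans (cong (p ↑ʳ_) (FinP.splitAt⁻¹-↑ʳ eq′)) (FinP.splitAt⁻¹-↑ʳ eq)

    sumV : (V → ℤ) → ℤ
    sumV f = sum (λ a → f (inj₁ a)) + (sum (λ c → f (inj₂ (inj₁ c))) + sum (λ b → f (inj₂ (inj₂ b))))

    sumV-cong : ∀ {f g : V → ℤ} → f ≗ g → sumV f ≡ sumV g
    sumV-cong f≗g = cong₂ _+_ (sum-cong-≗ (λ a → f≗g (inj₁ a)))
      (cong₂ _+_ (sum-cong-≗ (λ c → f≗g (inj₂ (inj₁ c)))) (sum-cong-≗ (λ b → f≗g (inj₂ (inj₂ b)))))

    sum-index : ∀ (g : Fin NV → ℤ) → sum g ≡ sumV (λ v → g (index v))
    sum-index g = trans (sum-++ p g) (cong (_+_ (sum (λ a → g (a ↑ˡ (n ℕ.+ q))))) (sum-++ n (λ x → g (p ↑ʳ x))))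

    flow : (V → V → ℕ) → ZVec V → ZVec V
    flow μ Y v = sumV (λ w → + μ v w * (Y v - Y w))

    flow-cong : ∀ μ {Y Y′} → Y ≗ Y′ → flow μ Y ≗ flow μ Y′
    flow-cong μ Y≗Y′ v = sumV-cong (λ w → cong₂ (λ a b → + μ v w * (a - b)) (Y≗Y′ v) (Y≗Y′ w))

    laplacian-flow : ∀ (μ : V → V → ℕ) y u →
      (laplacian (λ u w → μ (classify p k q u) (classify p k q w)) ▷ y) u
        ≡ flow μ (λ v → y (index v)) (classify p k q u)
    laplacian-flow μ y u = trans (laplacian-▷ μ′ y u) (trans (sum-index (λ w → + μ′ u w * (y u - y w)))
      (sumV-cong (λ v → cong₂ (λ w x → + μ (classify p k q u) w * (x - y (index v)))
                             (classify-index v) (sym (cong y (index-classify u))))))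
      where μ′ = λ u w → μ (classify p k q u) (classify p k q w)

    laplacianIso : ∀ (μ : V → V → ℕ) →
      LatticeIso (Span (laplacian (λ u w → μ (classify p k q u) (classify p k q w)) ▷_)) (Span (flow μ))
    laplacianIso μ =
      spanIso (reindex (classify p k q) index classify-index index-classify)
        (laplacian (λ u w → μ (classify p k q u) (classify p k q w)) ▷_) (flow μ)
        (λ z v → z (index v)) (λ Y u → Y (classify p k q u)) (flow-cong μ)
        (λ Y v → cong Y (classify-index v)) (λ z u → sym (laplacian-flow μ z u))

  ind-refl : ∀ x → ind x x ≡ 1
  ind-refl zero    = refl
  ind-refl (suc x) = ind-refl x

  ind-≢ : ∀ x y → (x ≡ y → ⊥) → ind x y ≡ 0
  ind-≢ zero    zero    x≢y = ⊥-elim (x≢y refl)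
  ind-≢ zero    (suc y) x≢y = refl
  ind-≢ (suc x) zero    x≢y = refl
  ind-≢ (suc x) (suc y) x≢y = ind-≢ x y (λ x≡y → x≢y (cong suc x≡y))

  δ : ∀ {n} → Fin n → Fin n → ℤ
  δ J c = + ind (toℕ c) (toℕ J)

  δ-self : ∀ {n} (J : Fin n) → δ J J ≡ + 1
  δ-self J = cong +_ (ind-refl (toℕ J))

  δ-≢ : ∀ {n} {J c : Fin n} → (c ≡ J → ⊥) → δ J c ≡ + 0
  δ-≢ {J = J} {c} c≢J = cong +_ (ind-≢ (toℕ c) (toℕ J) (λ e → c≢J (FinP.toℕ-injective e)))

  δ-resp : ∀ {n} {J c J′ c′ : Fin n} → (c ≡ J → c′ ≡ J′) → (c′ ≡ J′ → c ≡ J) → δ J c ≡ δ J′ c′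
  δ-resp {J = J} {c} {J′} {c′} ⇒ ⇐ with c Fin.≟ J
  ... | yes refl = trans (δ-self J) (sym (subst (λ x → δ J′ x ≡ + 1) (sym (⇒ refl)) (δ-self J′)))
  ... | no c≢J   = trans (δ-≢ c≢J) (sym (δ-≢ (λ e → c≢J (⇐ e))))

  δ-localizes : ∀ {n} (J c : Fin n) (y : Fin n → ℤ) → δ J c * (y c - y J) ≡ + 0
  δ-localizes J c y with c Fin.≟ J
  ... | yes refl = trans (cong (δ J J *_) (ℤP.+-inverseʳ (y J))) (ℤP.*-zeroʳ (δ J J))
  ... | no c≢J   = trans (cong (_* (y c - y J)) (δ-≢ c≢J)) (ℤP.*-zeroˡ (y c - y J))

  δ-idempotent : ∀ {n} (J c : Fin n) → δ J c * δ J c ≡ δ J c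
  δ-idempotent J c with c Fin.≟ J
  ... | yes refl = trans (cong (λ d → d * d) (δ-self J)) (sym (δ-self J))
  ... | no c≢J   = trans (cong (λ d → d * d) (δ-≢ c≢J)) (sym (δ-≢ c≢J))

  δ-disjoint : ∀ {n} {J J′ : Fin n} → (J ≡ J′ → ⊥) → ∀ c → δ J c * δ J′ c ≡ + 0
  δ-disjoint {J = J} {J′} J≢J′ c with c Fin.≟ J
  ... | yes refl = trans (cong (δ J J *_) (δ-≢ J≢J′)) (ℤP.*-zeroʳ (δ J J))
  ... | no c≢J   = trans (cong (_* δ J′ c) (δ-≢ c≢J)) (ℤP.*-zeroˡ (δ J′ c))

  ind-as-δ : ∀ {n} (J c : Fin n) {j} → toℕ J ≡ j → + ind (toℕ c) j ≡ δ J c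
  ind-as-δ J c refl = refl

  sum-δ : ∀ {N} (J : Fin N) (g : Fin N → ℤ) → sum (λ c → δ J c * g c) ≡ g J
  sum-δ J g = trans (sum-cong-≗ as-delta) (sum-delta J g)
    where
    as-delta : ∀ c → δ J c * g c ≡ (if does (J Fin.≟ c) then g c else 0ℤ)
    as-delta c with J Fin.≟ c
    ... | yes refl = trans (cong (_* g J) (δ-self J)) (ℤP.*-identityˡ (g J))
    ... | no J≢c   = trans (cong (_* g c) (δ-≢ (λ e → J≢c (sym e)))) (ℤP.*-zeroˡ (g c))

  next : ∀ {n} → Fin (suc n) → Fin (suc n)
  next {n} c = suc (toℕ c) ℕD.mod suc n

  prev : ∀ {n} → Fin (suc n) → Fin (suc n)
  prev {n}     fzero    = fromℕ n
  prev {suc n} (fsuc j) = inject₁ j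

  toℕ-next : ∀ {n} (c : Fin (suc n)) → toℕ (next c) ≡ suc (toℕ c) ℕ.% suc n
  toℕ-next {n} c = FinP.toℕ-fromℕ< (ℕD.m%n<n (suc (toℕ c)) (suc n))

  next-prev : ∀ {n} (c : Fin (suc n)) → next (prev c) ≡ c
  next-prev {n} fzero = FinP.toℕ-injective
    (trans (toℕ-next (fromℕ n)) (trans (cong (λ z → suc z ℕ.% suc n) (FinP.toℕ-fromℕ n)) (ℕD.n%n≡0 (suc n))))
  next-prev {suc n} (fsuc j) = FinP.toℕ-injective
    (trans (toℕ-next (inject₁ j)) (trans (cong (λ z → suc z ℕ.% suc (suc n)) (FinP.toℕ-inject₁ j))
           (ℕD.m<n⇒m%n≡m (FinP.toℕ<n (fsuc j)))))

  toℕ-prev : ∀ {n} (x : Fin (suc n)) {m} → toℕ x ≡ suc m → toℕ (prev x) ≡ m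
  toℕ-prev {suc n} (fsuc j) eq = trans (FinP.toℕ-inject₁ j) (ℕP.suc-injective eq)

  prev-next : ∀ {n} (c : Fin (suc n)) → prev (next c) ≡ c
  prev-next {n} c with ℕP.<-cmp (toℕ c) n
  ... | tri< c<n _ _ = FinP.toℕ-injective (toℕ-prev (next c) (trans (toℕ-next c) (ℕD.m<n⇒m%n≡m (ℕ.s≤s c<n))))
  ... | tri≈ _ c≡n _ = FinP.toℕ-injective (trans (cong (λ z → toℕ (prev z)) next≡0) (trans (FinP.toℕ-fromℕ n) (sym c≡n)))
    where
    next≡0 : next c ≡ fzero
    next≡0 = FinP.toℕ-injective (trans (toℕ-next c) (trans (cong (λ z → suc z ℕ.% suc n) c≡n) (ℕD.n%n≡0 (suc n))))
  ... | tri> _ _ c>n = ⊥-elim (ℕP.<-irrefl refl (ℕP.<-≤-trans c>n (ℕ.s≤s⁻¹ (FinP.toℕ<n c))))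

  next-injective : ∀ {n} (a b : Fin (suc n)) → next a ≡ next b → a ≡ b
  next-injective a b eq = trans (sym (prev-next a)) (trans (cong prev eq) (prev-next b))

  cycle-sum : ∀ {n} (c : Fin (suc n)) (g : Fin (suc n) → ℤ) →
    sum (λ c′ → + cycMult c c′ * g c′) ≡ g (next c) + g (prev c)
  cycle-sum c g = begin
    sum (λ c′ → + cycMult c c′ * g c′)
      ≡⟨ sum-cong-≗ (λ c′ → trans (cong (_* g c′) (ℤP.pos-+ (ind (toℕ c′) (toℕ (next c))) (ind (toℕ c) (toℕ (next c′)))))
                                  (ℤP.*-distribʳ-+ (g c′) (δ (next c) c′) (δ (next c′) c))) ⟩
    sum (λ c′ → δ (next c) c′ * g c′ + δ (next c′) c * g c′)
      ≡⟨ ∑-distrib-+ (λ c′ → δ (next c) c′ * g c′) (λ c′ → δ (next c′) c * g c′) ⟩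
    sum (λ c′ → δ (next c) c′ * g c′) + sum (λ c′ → δ (next c′) c * g c′)
      ≡⟨ cong₂ _+_ (sum-δ (next c) g) (trans (sum-cong-≗ (λ c′ → cong (_* g c′) (predecessor c′))) (sum-δ (prev c) g)) ⟩
    g (next c) + g (prev c) ∎
    where
    open ≡-Reasoning
    predecessor : ∀ c′ → δ (next c′) c ≡ δ (prev c) c′
    predecessor c′ = δ-resp (λ e → trans (sym (prev-next c′)) (cong prev (sym e)))
                            (λ e → trans (sym (next-prev c)) (cong next (sym e)))

  total : ∀ {m} → (Fin m → ℕ) → ℤ
  total w = sum (λ a → + w a)

  moment : ∀ {m} → (Fin m → ℕ) → (Fin m → ℤ) → ℤ
  moment w Y = sum (λ a → + w a * Y a)

  moment-sub : ∀ {m} (w : Fin m → ℕ) (y : ℤ) (Y : Fin m → ℤ) →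
    sum (λ a → + w a * (y - Y a)) ≡ total w * y - moment w Y
  moment-sub w y Y = begin
    sum (λ a → + w a * (y - Y a))             ≡⟨ sum-cong-≗ (λ a → distrib (+ w a) y (Y a)) ⟩
    sum (λ a → + w a * y - + w a * Y a)       ≡⟨ sum-- (λ a → + w a * y) (λ a → + w a * Y a) ⟩
    sum (λ a → + w a * y) - moment w Y        ≡⟨ cong (_- moment w Y) (sym (*-distribʳ-sum y (λ a → + w a))) ⟩
    total w * y - moment w Y                  ∎
    where
    open ≡-Reasoning
    distrib : ∀ (m a b : ℤ) → m * (a - b) ≡ m * a - m * b
    distrib = solve-∀

  pos-linear : ∀ a b c d → + (a ℕ.* b ℕ.+ c ℕ.* d) ≡ + a * + b + + c * + d
  pos-linear a b c d = trans (ℤP.pos-+ (a ℕ.* b) (c ℕ.* d)) (cong₂ _+_ (ℤP.pos-* a b) (ℤP.pos-* c d))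

  attach-sum : ∀ {m} (w₁ w₂ : Fin m → ℕ) (I₁ I₂ : ℕ) (y : ℤ) (Y : Fin m → ℤ) →
    sum (λ a → + (w₁ a ℕ.* I₁ ℕ.+ w₂ a ℕ.* I₂) * (y - Y a))
      ≡ + I₁ * (total w₁ * y - moment w₁ Y) + + I₂ * (total w₂ * y - moment w₂ Y)
  attach-sum w₁ w₂ I₁ I₂ y Y = begin
    sum (λ a → + (w₁ a ℕ.* I₁ ℕ.+ w₂ a ℕ.* I₂) * (y - Y a))
      ≡⟨ sum-cong-≗ (λ a → trans (cong (_* (y - Y a)) (pos-linear (w₁ a) I₁ (w₂ a) I₂)) (regroup (+ w₁ a) (+ I₁) (+ w₂ a) (+ I₂) (y - Y a))) ⟩
    sum (λ a → + I₁ * (+ w₁ a * (y - Y a)) + + I₂ * (+ w₂ a * (y - Y a)))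
      ≡⟨ ∑-distrib-+ (λ a → + I₁ * (+ w₁ a * (y - Y a))) (λ a → + I₂ * (+ w₂ a * (y - Y a))) ⟩
    sum (λ a → + I₁ * (+ w₁ a * (y - Y a))) + sum (λ a → + I₂ * (+ w₂ a * (y - Y a)))
      ≡⟨ cong₂ _+_ (trans (sym (*-distribˡ-sum (+ I₁) (λ a → + w₁ a * (y - Y a)))) (cong (+ I₁ *_) (moment-sub w₁ y Y)))
                   (trans (sym (*-distribˡ-sum (+ I₂) (λ a → + w₂ a * (y - Y a)))) (cong (+ I₂ *_) (moment-sub w₂ y Y))) ⟩
    + I₁ * (total w₁ * y - moment w₁ Y) + + I₂ * (total w₂ * y - moment w₂ Y) ∎
    where
    open ≡-Reasoning
    regroup : ∀ (a i b j x : ℤ) → (a * i + b * j) * x ≡ i * (a * x) + j * (b * x)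
    regroup = solve-∀

  sum-two-points : ∀ {N} (A B : ℕ) (J₁ J₂ : Fin N) (j₁ j₂ : ℕ) → toℕ J₁ ≡ j₁ → toℕ J₂ ≡ j₂ → (g : Fin N → ℤ) →
    sum (λ c → + (A ℕ.* ind (toℕ c) j₁ ℕ.+ B ℕ.* ind (toℕ c) j₂) * g c) ≡ + A * g J₁ + + B * g J₂
  sum-two-points A B J₁ J₂ _ _ refl refl g = begin
    sum (λ c → + (A ℕ.* ind (toℕ c) (toℕ J₁) ℕ.+ B ℕ.* ind (toℕ c) (toℕ J₂)) * g c)
      ≡⟨ sum-cong-≗ (λ c → trans (cong (_* g c) (pos-linear A (ind (toℕ c) (toℕ J₁)) B (ind (toℕ c) (toℕ J₂))))
                                 (regroup (+ A) (+ ind (toℕ c) (toℕ J₁)) (+ B) (+ ind (toℕ c) (toℕ J₂)) (g c))) ⟩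
    sum (λ c → + A * (+ ind (toℕ c) (toℕ J₁) * g c) + + B * (+ ind (toℕ c) (toℕ J₂) * g c))
      ≡⟨ ∑-distrib-+ (λ c → + A * (+ ind (toℕ c) (toℕ J₁) * g c)) (λ c → + B * (+ ind (toℕ c) (toℕ J₂) * g c)) ⟩
    sum (λ c → + A * (+ ind (toℕ c) (toℕ J₁) * g c)) + sum (λ c → + B * (+ ind (toℕ c) (toℕ J₂) * g c))
      ≡⟨ cong₂ _+_ (trans (sym (*-distribˡ-sum (+ A) (λ c → + ind (toℕ c) (toℕ J₁) * g c))) (cong (+ A *_) (sum-δ J₁ g)))
                   (trans (sym (*-distribˡ-sum (+ B) (λ c → + ind (toℕ c) (toℕ J₂) * g c))) (cong (+ B *_) (sum-δ J₂ g))) ⟩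
    + A * g J₁ + + B * g J₂ ∎
    where
    open ≡-Reasoning
    regroup : ∀ (a x b y g : ℤ) → (a * x + b * y) * g ≡ a * (x * g) + b * (y * g)
    regroup = solve-∀

  symmetric-flow-vanishes : ∀ {m} (B : Fin m → Fin m → ℤ) → (∀ a b → B a b ≡ B b a) → (Y : Fin m → ℤ) →
    sum (λ a → sum (λ b → B a b * (Y a - Y b))) ≡ 0ℤ
  symmetric-flow-vanishes B B-sym Y = x≡-x⇒x≡0 X X≡-X
    where
    X = sum (λ a → sum (λ b → B a b * (Y a - Y b)))
    swap-sign : ∀ (c x y : ℤ) → c * (x - y) ≡ - (c * (y - x))
    swap-sign = solve-∀
    X≡-X : X ≡ - X
    X≡-X = begin
      X                                                   ≡⟨ ∑-comm (λ a b → B a b * (Y a - Y b)) ⟩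
      sum (λ b → sum (λ a → B a b * (Y a - Y b)))         ≡⟨ sum-cong-≗ (λ b → sum-cong-≗ (λ a → trans (cong (_* (Y a - Y b)) (B-sym a b)) (swap-sign (B b a) (Y a) (Y b)))) ⟩
      sum (λ b → sum (λ a → - (B b a * (Y b - Y a))))     ≡⟨ sum-cong-≗ (λ b → sum-neg (λ a → B b a * (Y b - Y a))) ⟩
      sum (λ b → - sum (λ a → B b a * (Y b - Y a)))       ≡⟨ sum-neg (λ b → sum (λ a → B b a * (Y b - Y a))) ⟩
      - X                                                 ∎
      where open ≡-Reasoning
    x≡-x⇒x≡0 : ∀ x → x ≡ - x → x ≡ 0ℤ
    x≡-x⇒x≡0 x x≡-x with ℤP.i*j≡0⇒i≡0∨j≡0 (+ 2) {x} (trans (double x) (trans (cong (_+_ x) x≡-x) (ℤP.+-inverseʳ x)))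
      where double : ∀ (x : ℤ) → + 2 * x ≡ x + x
            double = solve-∀
    ... | inj₁ ()
    ... | inj₂ x≡0 = x≡0

  -- The passage from H_i to H_(i+1), for 0 ≤ i ≤ k.  The cycle vertices involved are the
  -- pivot s = t_(i+1), its predecessor t (where f₁ attaches in H_i) and its successor s₁.
  module Step (p q k : ℕ)
    (adjF : Fin p → Fin p → Bool) (adjF-sym : ∀ a b → adjF a b ≡ adjF b a)
    (adjG : Fin q → Fin q → Bool)
    (f₁ f₂ : Fin p → ℕ) (g₁ g₂ : Fin q → ℕ) (i : ℕ) (i≤k : i ≤ k) where

    open Vertices p k q

    μ : ℕ → V → V → ℕ
    μ = multS k adjF adjG f₁ f₂ g₁ g₂

    F : Fin p → V
    F = inj₁
    T : Fin n → V
    T c = inj₂ (inj₁ c)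
    G : Fin q → V
    G b = inj₂ (inj₂ b)

    i<n : i ℕ.< n
    i<n = ℕ.s≤s (ℕP.m≤n⇒m≤1+n (ℕP.m≤n⇒m≤1+n i≤k))
    1+i<n : suc i ℕ.< n
    1+i<n = ℕ.s≤s (ℕ.s≤s (ℕP.m≤n⇒m≤1+n i≤k))
    predecessor<n : f₁target k i ℕ.< n
    predecessor<n = bound i i≤k
      where
      bound : ∀ j → j ≤ k → f₁target k j ℕ.< n
      bound zero    _           = ℕP.n<1+n (suc (suc k))
      bound (suc j) (ℕ.s≤s j≤k) = ℕ.s≤s (ℕP.m≤n⇒m≤1+n (ℕP.m≤n⇒m≤1+n (ℕP.m≤n⇒m≤1+n j≤k)))
    1+k<n : suc k ℕ.< n
    1+k<n = ℕ.s≤s (ℕ.s≤s (ℕP.n≤1+n k))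
    2+k<n : suc (suc k) ℕ.< n
    2+k<n = ℕP.n<1+n (suc (suc k))

    s s₁ t gAt₁ gAt₂ : Fin n
    s     = fromℕ< i<n
    s₁    = fromℕ< 1+i<n
    t     = fromℕ< predecessor<n
    gAt₁  = fromℕ< 1+k<n
    gAt₂  = fromℕ< 2+k<n

    toℕ-s : toℕ s ≡ i
    toℕ-s = FinP.toℕ-fromℕ< i<n
    toℕ-s₁ : toℕ s₁ ≡ suc i
    toℕ-s₁ = FinP.toℕ-fromℕ< 1+i<n
    toℕ-t : toℕ t ≡ f₁target k i
    toℕ-t = FinP.toℕ-fromℕ< predecessor<n
    toℕ-gAt₁ : toℕ gAt₁ ≡ suc k
    toℕ-gAt₁ = FinP.toℕ-fromℕ< 1+k<n
    toℕ-gAt₂ : toℕ gAt₂ ≡ suc (suc k)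
    toℕ-gAt₂ = FinP.toℕ-fromℕ< 2+k<n

    distinct : ∀ {a b : Fin n} {x y} → toℕ a ≡ x → toℕ b ≡ y → (x ≡ y → ⊥) → a ≡ b → ⊥
    distinct refl refl x≢y a≡b = x≢y (cong toℕ a≡b)

    s₁≢s : s₁ ≡ s → ⊥
    s₁≢s = distinct toℕ-s₁ toℕ-s (ℕP.1+n≢n)
    t≢s : t ≡ s → ⊥
    t≢s = distinct toℕ-t toℕ-s (predecessor≢ i)
      where predecessor≢ : ∀ j → f₁target k j ≡ j → ⊥
            predecessor≢ zero    ()
            predecessor≢ (suc j) e = ℕP.1+n≢n (sym e)
    gAt₁≢s : gAt₁ ≡ s → ⊥
    gAt₁≢s = distinct toℕ-gAt₁ toℕ-s (λ e → ℕP.<-irrefl (sym e) (ℕ.s≤s i≤k))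
    gAt₂≢s : gAt₂ ≡ s → ⊥
    gAt₂≢s = distinct toℕ-gAt₂ toℕ-s (λ e → ℕP.<-irrefl (sym e) (ℕ.s≤s (ℕP.m≤n⇒m≤1+n i≤k)))

    next-s : next s ≡ s₁
    next-s = FinP.toℕ-injective (trans (toℕ-next s)
      (trans (cong (λ z → suc z ℕ.% n) toℕ-s) (trans (ℕD.m<n⇒m%n≡m 1+i<n) (sym toℕ-s₁))))
    next-t : next t ≡ s
    next-t = FinP.toℕ-injective (trans (toℕ-next t) (trans (cong (λ z → suc z ℕ.% n) toℕ-t) (trans (wraps i i≤k) (sym toℕ-s))))
      where
      wraps : ∀ j → j ≤ k → suc (f₁target k j) ℕ.% n ≡ j
      wraps zero    _   = ℕD.n%n≡0 n
      wraps (suc j) j≤k = ℕD.m<n⇒m%n≡m (ℕ.s≤s (ℕP.m≤n⇒m≤1+n (ℕP.m≤n⇒m≤1+n j≤k)))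
    prev-s : prev s ≡ t
    prev-s = trans (cong prev (sym next-t)) (prev-next t)
    prev-s₁ : prev s₁ ≡ s
    prev-s₁ = trans (cong prev (sym next-s)) (prev-next s)

    δ-next : ∀ c → δ s (next c) ≡ δ t c
    δ-next c = δ-resp (λ e → next-injective c t (trans e (sym next-t))) (λ e → trans (cong next e) next-t)
    δ-prev : ∀ c → δ s (prev c) ≡ δ s₁ c
    δ-prev c = δ-resp (λ e → trans (sym (next-prev c)) (trans (cong next e) next-s))
                      (λ e → trans (cong prev e) prev-s₁)

    ΣF : ZVec V → ℤ
    ΣF X = sum (λ a → X (F a))

    -- A row operation on the cycle coordinates (used with (a, b) = (t, s₁) and, as its
    -- inverse, (s₁, t)):  s ↦ −X_s − ΣF X,  a ↦ X_a + X_s,  b ↦ X_b + X_s + ΣF X.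
    -- On the cycle coordinate c the operation is determined by the indicators of c = s, a, b.
    rowOpT : (ds da db : ℤ) → ZVec V → Fin n → ℤ
    rowOpT ds da db X c = X (T c) + ds * (- (X (T s) + X (T s)) - ΣF X) + da * X (T s) + db * (X (T s) + ΣF X)

    rowOp : Fin n → Fin n → ZVec V → ZVec V
    rowOp a b X (inj₁ x)        = X (inj₁ x)
    rowOp a b X (inj₂ (inj₁ c)) = rowOpT (δ s c) (δ a c) (δ b c) X c
    rowOp a b X (inj₂ (inj₂ y)) = X (inj₂ (inj₂ y))

    -- A change of potentials (used with (a, b) = (t, s₁) and, as its inverse, (s₁, t)):
    -- F is shifted by Y_a − Y_s and Y_s is replaced by Y_a + Y_b − Y_s.
    shift : Fin n → Fin n → ZVec V → ZVec V
    shift a b Y (inj₁ x)        = Y (inj₁ x) + Y (T a) - Y (T s)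
    shift a b Y (inj₂ (inj₁ c)) = Y (T c) + δ s c * (Y (T a) + Y (T b) - (Y (T s) + Y (T s)))
    shift a b Y (inj₂ (inj₂ y)) = Y (inj₂ (inj₂ y))

    rowOp-at-s : ∀ a b → (s ≡ a → ⊥) → (s ≡ b → ⊥) → ∀ X → rowOp a b X (T s) ≡ - X (T s) - ΣF X
    rowOp-at-s a b s≢a s≢b X =
      trans (cong₃ (λ ds da db → rowOpT ds da db X s) (δ-self s) (δ-≢ s≢a) (δ-≢ s≢b)) (simplify (X (T s)) (ΣF X))
      where
      simplify : ∀ (x σ : ℤ) → x + + 1 * (- (x + x) - σ) + + 0 * x + + 0 * (x + σ) ≡ - x - σ
      simplify = solve-∀

    rowOp-inverse : ∀ a b → (s ≡ a → ⊥) → (s ≡ b → ⊥) → ∀ X → rowOp a b (rowOp b a X) ≗ X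
    rowOp-inverse a b s≢a s≢b X (inj₁ x)        = refl
    rowOp-inverse a b s≢a s≢b X (inj₂ (inj₂ y)) = refl
    rowOp-inverse a b s≢a s≢b X (inj₂ (inj₁ c)) =
      trans (cong (λ ys → rowOp b a X (T c) + δ s c * (- (ys + ys) - ΣF X) + δ a c * ys + δ b c * (ys + ΣF X))
                  (rowOp-at-s b a s≢b s≢a X))
            (cancel (X (T c)) (X (T s)) (ΣF X) (δ s c) (δ a c) (δ b c))
      where
      cancel : ∀ (xc xs σ ds da db : ℤ) →
        (xc + ds * (- (xs + xs) - σ) + db * xs + da * (xs + σ))
          + ds * (- ((- xs - σ) + (- xs - σ)) - σ) + da * (- xs - σ) + db * ((- xs - σ) + σ) ≡ xc
      cancel = solve-∀

    rowOp-cong : ∀ a b {X X′} → X ≗ X′ → rowOp a b X ≗ rowOp a b X′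
    rowOp-cong a b X≗X′ (inj₁ x)        = X≗X′ (inj₁ x)
    rowOp-cong a b X≗X′ (inj₂ (inj₂ y)) = X≗X′ (inj₂ (inj₂ y))
    rowOp-cong a b X≗X′ (inj₂ (inj₁ c)) =
      cong₃ (λ xc xs σ → xc + δ s c * (- (xs + xs) - σ) + δ a c * xs + δ b c * (xs + σ))
            (X≗X′ (T c)) (X≗X′ (T s)) (sum-cong-≗ (λ x → X≗X′ (F x)))

    rowOp-⊕ : ∀ a b X X′ → rowOp a b (X ⊕ X′) ≗ rowOp a b X ⊕ rowOp a b X′
    rowOp-⊕ a b X X′ (inj₁ x)        = refl
    rowOp-⊕ a b X X′ (inj₂ (inj₂ y)) = refl
    rowOp-⊕ a b X X′ (inj₂ (inj₁ c)) =
      trans (cong (λ σ → X (T c) + X′ (T c) + δ s c * (- ((X (T s) + X′ (T s)) + (X (T s) + X′ (T s))) - σ)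
                         + δ a c * (X (T s) + X′ (T s)) + δ b c * ((X (T s) + X′ (T s)) + σ))
                  (∑-distrib-+ (λ x → X (F x)) (λ x → X′ (F x))))
            (distribute (X (T c)) (X′ (T c)) (X (T s)) (X′ (T s)) (ΣF X) (ΣF X′) (δ s c) (δ a c) (δ b c))
      where
      distribute : ∀ (x x′ y y′ σ σ′ ds da db : ℤ) →
        x + x′ + ds * (- ((y + y′) + (y + y′)) - (σ + σ′)) + da * (y + y′) + db * ((y + y′) + (σ + σ′))
          ≡ (x + ds * (- (y + y) - σ) + da * y + db * (y + σ)) + (x′ + ds * (- (y′ + y′) - σ′) + da * y′ + db * (y′ + σ′))
      distribute = solve-∀

    s≢t : s ≡ t → ⊥
    s≢t e = t≢s (sym e)
    s≢s₁ : s ≡ s₁ → ⊥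
    s≢s₁ e = s₁≢s (sym e)

    rowOpIso : AdditiveIso V V
    rowOpIso = record
      { to = rowOp t s₁ ; from = rowOp s₁ t
      ; to-cong = rowOp-cong t s₁ ; from-cong = rowOp-cong s₁ t ; to-⊕ = rowOp-⊕ t s₁
      ; to-from = rowOp-inverse t s₁ s≢t s≢s₁ ; from-to = rowOp-inverse s₁ t s≢s₁ s≢t }

    shift-at-s : ∀ a b Y → shift a b Y (T s) ≡ Y (T a) + Y (T b) - Y (T s)
    shift-at-s a b Y = trans (cong (λ d → Y (T s) + d * (Y (T a) + Y (T b) - (Y (T s) + Y (T s)))) (δ-self s))
                              (simplify (Y (T s)) (Y (T a)) (Y (T b)))
      where
      simplify : ∀ (x y z : ℤ) → x + + 1 * (y + z - (x + x)) ≡ y + z - x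
      simplify = solve-∀

    shift-away : ∀ a b Y c → (c ≡ s → ⊥) → shift a b Y (T c) ≡ Y (T c)
    shift-away a b Y c c≢s =
      trans (cong (λ d → Y (T c) + d * (Y (T a) + Y (T b) - (Y (T s) + Y (T s)))) (δ-≢ c≢s))
            (trans (cong (_+_ (Y (T c))) (ℤP.*-zeroˡ (Y (T a) + Y (T b) - (Y (T s) + Y (T s))))) (ℤP.+-identityʳ (Y (T c))))

    shift-inverse : ∀ a b → (a ≡ s → ⊥) → (b ≡ s → ⊥) → ∀ Y → shift a b (shift b a Y) ≗ Y
    shift-inverse a b a≢s b≢s Y (inj₁ x) =
      trans (cong₂ (λ za zs → Y (F x) + Y (T b) - Y (T s) + za - zs) (shift-away b a Y a a≢s) (shift-at-s b a Y))
            (cancel (Y (F x)) (Y (T a)) (Y (T b)) (Y (T s)))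
      where
      cancel : ∀ (y ya yb ys : ℤ) → y + yb - ys + ya - (yb + ya - ys) ≡ y
      cancel = solve-∀
    shift-inverse a b a≢s b≢s Y (inj₂ (inj₂ y)) = refl
    shift-inverse a b a≢s b≢s Y (inj₂ (inj₁ c)) =
      trans (cong₂ (λ zab zs → Y (T c) + δ s c * (Y (T b) + Y (T a) - (Y (T s) + Y (T s))) + δ s c * (zab - (zs + zs)))
                   (cong₂ _+_ (shift-away b a Y a a≢s) (shift-away b a Y b b≢s)) (shift-at-s b a Y))
            (cancel (Y (T c)) (Y (T a)) (Y (T b)) (Y (T s)) (δ s c))
      where
      cancel : ∀ (yc ya yb ys d : ℤ) →
        yc + d * (yb + ya - (ys + ys)) + d * ((ya + yb) - ((yb + ya - ys) + (yb + ya - ys))) ≡ yc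
      cancel = solve-∀

    P₁ P₂ R₁ R₂ : ℤ
    P₁ = total f₁
    P₂ = total f₂
    R₁ = total g₁
    R₂ = total g₂

    Q₁ Q₂ S₁ S₂ : ZVec V → ℤ
    Q₁ Y = moment f₁ (λ a → Y (F a))
    Q₂ Y = moment f₂ (λ a → Y (F a))
    S₁ Y = moment g₁ (λ b → Y (G b))
    S₂ Y = moment g₂ (λ b → Y (G b))

    F-internal : ZVec V → Fin p → ℤ
    F-internal Y a = sum (λ a′ → + bool→ℕ (adjF a a′) * (Y (F a) - Y (F a′)))

    G-attach : ZVec V → Fin n → ℤ
    G-attach Y c = δ gAt₁ c * (R₁ * Y (T c) - S₁ Y) + δ gAt₂ c * (R₂ * Y (T c) - S₂ Y)

    -- The flow at a cycle vertex c, where F attaches with weight d₁ f₁ + d₂ f₂, c has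
    -- potential yc, its neighbours yn and yp, and G contributes g.
    cycleFlow : (d₁ d₂ yc yn yp q₁ q₂ g : ℤ) → ℤ
    cycleFlow d₁ d₂ yc yn yp q₁ q₂ g = (d₁ * (P₁ * yc - q₁) + d₂ * (P₂ * yc - q₂)) + (((yc - yn) + (yc - yp)) + g)

    module Level (j : ℕ) (J₁ J₂ : Fin n) (toℕ-J₁ : toℕ J₁ ≡ f₁target k j) (toℕ-J₂ : toℕ J₂ ≡ j) where

      flow-T : ∀ Y c → flow (μ j) Y (T c)
        ≡ cycleFlow (δ J₁ c) (δ J₂ c) (Y (T c)) (Y (T (next c))) (Y (T (prev c))) (Q₁ Y) (Q₂ Y) (G-attach Y c)
      flow-T Y c = cong₂ _+_
        (trans (attach-sum f₁ f₂ (ind (toℕ c) (f₁target k j)) (ind (toℕ c) j) (Y (T c)) (λ a → Y (F a)))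
               (cong₂ (λ d₁ d₂ → d₁ * (P₁ * Y (T c) - Q₁ Y) + d₂ * (P₂ * Y (T c) - Q₂ Y))
                      (ind-as-δ J₁ c toℕ-J₁) (ind-as-δ J₂ c toℕ-J₂)))
        (cong₂ _+_ (cycle-sum c (λ c′ → Y (T c) - Y (T c′)))
          (trans (attach-sum g₁ g₂ (ind (toℕ c) (suc k)) (ind (toℕ c) (suc (suc k))) (Y (T c)) (λ b → Y (G b)))
                 (cong₂ (λ d₁ d₂ → d₁ * (R₁ * Y (T c) - S₁ Y) + d₂ * (R₂ * Y (T c) - S₂ Y))
                        (ind-as-δ gAt₁ c toℕ-gAt₁) (ind-as-δ gAt₂ c toℕ-gAt₂))))

      flow-T-at : ∀ Y c {d₁ d₂ yc yn yp q₁ q₂ g} → δ J₁ c ≡ d₁ → δ J₂ c ≡ d₂ →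
        Y (T c) ≡ yc → Y (T (next c)) ≡ yn → Y (T (prev c)) ≡ yp → Q₁ Y ≡ q₁ → Q₂ Y ≡ q₂ → G-attach Y c ≡ g →
        flow (μ j) Y (T c) ≡ cycleFlow d₁ d₂ yc yn yp q₁ q₂ g
      flow-T-at Y c refl refl refl refl refl refl refl refl = flow-T Y c

      flow-F : ∀ Y a → flow (μ j) Y (F a)
        ≡ F-internal Y a + (+ f₁ a * (Y (F a) - Y (T J₁)) + + f₂ a * (Y (F a) - Y (T J₂)))
      flow-F Y a = cong (_+_ (F-internal Y a))
        (trans (cong₂ _+_ (sum-two-points (f₁ a) (f₂ a) J₁ J₂ (f₁target k j) j toℕ-J₁ toℕ-J₂ (λ c → Y (F a) - Y (T c)))
                          (no-edges (λ b → Y (F a) - Y (G b))))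
               (ℤP.+-identityʳ _))
        where
        no-edges : ∀ {m} (g : Fin m → ℤ) → sum (λ x → + 0 * g x) ≡ 0ℤ
        no-edges {m} g = trans (sum-cong-≗ (λ x → ℤP.*-zeroˡ (g x))) (sum-zero {m})

    module Hᵢ   = Level i t s toℕ-t toℕ-s
    module Hᵢ₊₁ = Level (suc i) s s₁ toℕ-s toℕ-s₁

    F-internal-shift : ∀ a b Y x → F-internal (shift a b Y) x ≡ F-internal Y x
    F-internal-shift a b Y x = sum-cong-≗ (λ x′ → cong (+ bool→ℕ (adjF x x′) *_)
      (same-difference (Y (F x)) (Y (F x′)) (Y (T a)) (Y (T s))))
      where same-difference : ∀ (u v c d : ℤ) → (u + c - d) - (v + c - d) ≡ u - v
            same-difference = solve-∀

    moment-shift : ∀ a b (w : Fin p → ℕ) Y →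
      moment w (λ x → shift a b Y (F x)) ≡ moment w (λ x → Y (F x)) + total w * (Y (T a) - Y (T s))
    moment-shift a b w Y = begin
      sum (λ x → + w x * (Y (F x) + Y (T a) - Y (T s)))
        ≡⟨ sum-cong-≗ (λ x → distrib (+ w x) (Y (F x)) (Y (T a)) (Y (T s))) ⟩
      sum (λ x → + w x * Y (F x) + + w x * (Y (T a) - Y (T s)))
        ≡⟨ ∑-distrib-+ (λ x → + w x * Y (F x)) (λ x → + w x * (Y (T a) - Y (T s))) ⟩
      moment w (λ x → Y (F x)) + sum (λ x → + w x * (Y (T a) - Y (T s)))
        ≡⟨ cong (_+_ (moment w (λ x → Y (F x)))) (sym (*-distribʳ-sum (Y (T a) - Y (T s)) (λ x → + w x))) ⟩
      moment w (λ x → Y (F x)) + total w * (Y (T a) - Y (T s)) ∎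
      where
      open ≡-Reasoning
      distrib : ∀ (m y a b : ℤ) → m * (y + a - b) ≡ m * y + m * (a - b)
      distrib = solve-∀

    s≢gAt₁ : s ≡ gAt₁ → ⊥
    s≢gAt₁ e = gAt₁≢s (sym e)
    s≢gAt₂ : s ≡ gAt₂ → ⊥
    s≢gAt₂ e = gAt₂≢s (sym e)

    G-attach-shift : ∀ a b Y c → G-attach (shift a b Y) c ≡ G-attach Y c
    G-attach-shift a b Y c with c Fin.≟ s
    ... | no c≢s   = cong (λ yc → δ gAt₁ c * (R₁ * yc - S₁ Y) + δ gAt₂ c * (R₂ * yc - S₂ Y)) (shift-away a b Y c c≢s)
    ... | yes refl =
      trans (cong₂ (λ d₁ d₂ → d₁ * (R₁ * shift a b Y (T s) - S₁ Y) + d₂ * (R₂ * shift a b Y (T s) - S₂ Y)) (δ-≢ s≢gAt₁) (δ-≢ s≢gAt₂))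
            (trans (vanish (shift a b Y (T s)) (Y (T s)) R₁ R₂ (S₁ Y) (S₂ Y))
                   (sym (cong₂ (λ d₁ d₂ → d₁ * (R₁ * Y (T s) - S₁ Y) + d₂ * (R₂ * Y (T s) - S₂ Y)) (δ-≢ s≢gAt₁) (δ-≢ s≢gAt₂))))
      where vanish : ∀ (y y′ r₁ r₂ σ₁ σ₂ : ℤ) → + 0 * (r₁ * y - σ₁) + + 0 * (r₂ * y - σ₂) ≡ + 0 * (r₁ * y′ - σ₁) + + 0 * (r₂ * y′ - σ₂)
            vanish = solve-∀

    G-attach-at-s : ∀ Y → G-attach Y s ≡ + 0
    G-attach-at-s Y =
      trans (cong₂ (λ d₁ d₂ → d₁ * (R₁ * Y (T s) - S₁ Y) + d₂ * (R₂ * Y (T s) - S₂ Y)) (δ-≢ s≢gAt₁) (δ-≢ s≢gAt₂))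
            (vanish (Y (T s)) R₁ R₂ (S₁ Y) (S₂ Y))
      where vanish : ∀ (y r₁ r₂ σ₁ σ₂ : ℤ) → + 0 * (r₁ * y - σ₁) + + 0 * (r₂ * y - σ₂) ≡ + 0
            vanish = solve-∀

    flow-at-s : ∀ Y → flow (μ (suc i)) Y (T s)
      ≡ cycleFlow (+ 1) (+ 0) (Y (T s)) (Y (T s₁)) (Y (T t)) (Q₁ Y) (Q₂ Y) (+ 0)
    flow-at-s Y = Hᵢ₊₁.flow-T-at Y s (δ-self s) (δ-≢ s≢s₁) refl (cong (λ c → Y (T c)) next-s)
                    (cong (λ c → Y (T c)) prev-s) refl refl (G-attach-at-s Y)

    -- Summing the flow over F: the edges inside F cancel, leaving the edges to s and s₁.
    ΣF-flow : ∀ Y → ΣF (flow (μ (suc i)) Y) ≡ (Q₁ Y - P₁ * Y (T s)) + (Q₂ Y - P₂ * Y (T s₁))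
    ΣF-flow Y = begin
      sum (λ a → flow (μ (suc i)) Y (F a))
        ≡⟨ sum-cong-≗ (Hᵢ₊₁.flow-F Y) ⟩
      sum (λ a → F-internal Y a + (+ f₁ a * (Y (F a) - Y (T s)) + + f₂ a * (Y (F a) - Y (T s₁))))
        ≡⟨ ∑-distrib-+ (F-internal Y) (λ a → + f₁ a * (Y (F a) - Y (T s)) + + f₂ a * (Y (F a) - Y (T s₁))) ⟩
      sum (F-internal Y) + sum (λ a → + f₁ a * (Y (F a) - Y (T s)) + + f₂ a * (Y (F a) - Y (T s₁)))
        ≡⟨ cong₂ _+_ (symmetric-flow-vanishes (λ a a′ → + bool→ℕ (adjF a a′)) (λ a a′ → cong (λ b → + bool→ℕ b) (adjF-sym a a′)) (λ a → Y (F a)))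
                     (∑-distrib-+ (λ a → + f₁ a * (Y (F a) - Y (T s))) (λ a → + f₂ a * (Y (F a) - Y (T s₁)))) ⟩
      0ℤ + (sum (λ a → + f₁ a * (Y (F a) - Y (T s))) + sum (λ a → + f₂ a * (Y (F a) - Y (T s₁))))
        ≡⟨ trans (ℤP.+-identityˡ _) (cong₂ _+_ (to-s f₁ (Y (T s))) (to-s f₂ (Y (T s₁)))) ⟩
      (Q₁ Y - P₁ * Y (T s)) + (Q₂ Y - P₂ * Y (T s₁)) ∎
      where
      open ≡-Reasoning
      to-s : ∀ (w : Fin p → ℕ) y → sum (λ a → + w a * (Y (F a) - y)) ≡ moment w (λ a → Y (F a)) - total w * y
      to-s w y = trans (sum-cong-≗ (λ a → distrib (+ w a) (Y (F a)) y))
        (trans (sum-- (λ a → + w a * Y (F a)) (λ a → + w a * y)) (cong (_-_ (moment w (λ a → Y (F a)))) (sym (*-distribʳ-sum y (λ a → + w a)))))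
        where distrib : ∀ (m a b : ℤ) → m * (a - b) ≡ m * a - m * b
              distrib = solve-∀

    -- The identity behind the step, at a cycle vertex c.  Writing ds, dt, ds₁ for the
    -- indicators of c = s, t, s₁, it holds modulo the relations satisfied by indicators.
    cycleIdentity : ∀ (ds dt ds₁ yc yn yp ys yt ys₁ q₁ q₂ g : ℤ) →
      ds * (yc - ys) ≡ + 0 → dt * (yc - yt) ≡ + 0 → ds₁ * (yc - ys₁) ≡ + 0 → ds * dt ≡ + 0 → ds * ds ≡ ds →
      let xs = cycleFlow (+ 1) (+ 0) ys ys₁ yt q₁ q₂ (+ 0)
          σ  = (q₁ - P₁ * ys) + (q₂ - P₂ * ys₁)
          Δ  = yt + ys₁ - (ys + ys)
      in cycleFlow ds ds₁ yc yn yp q₁ q₂ g + ds * (- (xs + xs) - σ) + dt * xs + ds₁ * (xs + σ)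
         ≡ cycleFlow dt ds (yc + ds * Δ) (yn + dt * Δ) (yp + ds₁ * Δ) (q₁ + P₁ * (yt - ys)) (q₂ + P₂ * (yt - ys)) g
    cycleIdentity ds dt ds₁ yc yn yp ys yt ys₁ q₁ q₂ g e₁ e₂ e₃ e₄ e₅ =
      trans (expand P₁ P₂ ds dt ds₁ yc yn yp ys yt ys₁ q₁ q₂ g)
            (trans (cong (_+_ rhs) (trans (cong₃ (λ A B C → correction A B C (ds * ds) (ds₁ * (yc - ys₁))) e₁ e₂ e₄)
                                   (trans (cong₂ (correction (+ 0) (+ 0) (+ 0)) e₅ e₃) (vanish P₁ P₂ ds Δ))))
                   (ℤP.+-identityʳ rhs))
      where
      Δ = yt + ys₁ - (ys + ys)
      rhs = cycleFlow dt ds (yc + ds * Δ) (yn + dt * Δ) (yp + ds₁ * Δ) (q₁ + P₁ * (yt - ys)) (q₂ + P₂ * (yt - ys)) g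
      correction : (A B C D E : ℤ) → ℤ
      correction A B C D E = P₁ * A - P₁ * B - P₁ * (C * Δ) + P₂ * ((ds - D) * Δ) - P₂ * A + P₂ * E
      vanish : ∀ (P₁ P₂ ds Δ : ℤ) →
        P₁ * + 0 - P₁ * + 0 - P₁ * (+ 0 * Δ) + P₂ * ((ds - ds) * Δ) - P₂ * + 0 + P₂ * + 0 ≡ + 0
      vanish = solve-∀
      expand : ∀ (P₁ P₂ ds dt ds₁ yc yn yp ys yt ys₁ q₁ q₂ g : ℤ) →
        let cf = λ d₁ d₂ yc yn yp q₁ q₂ g → (d₁ * (P₁ * yc - q₁) + d₂ * (P₂ * yc - q₂)) + (((yc - yn) + (yc - yp)) + g)
            xs = cf (+ 1) (+ 0) ys ys₁ yt q₁ q₂ (+ 0)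
            σ  = (q₁ - P₁ * ys) + (q₂ - P₂ * ys₁)
            Δ  = yt + ys₁ - (ys + ys)
        in cf ds ds₁ yc yn yp q₁ q₂ g + ds * (- (xs + xs) - σ) + dt * xs + ds₁ * (xs + σ)
           ≡ cf dt ds (yc + ds * Δ) (yn + dt * Δ) (yp + ds₁ * Δ) (q₁ + P₁ * (yt - ys)) (q₂ + P₂ * (yt - ys)) g
             + (P₁ * (ds * (yc - ys)) - P₁ * (dt * (yc - yt)) - P₁ * ((ds * dt) * Δ)
                + P₂ * ((ds - ds * ds) * Δ) - P₂ * (ds * (yc - ys)) + P₂ * (ds₁ * (yc - ys₁)))
      expand = solve-∀

    key-T : ∀ Y c → rowOp t s₁ (flow (μ (suc i)) Y) (T c) ≡ flow (μ i) (shift t s₁ Y) (T c)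
    key-T Y c =
      trans (cong₃ (λ xc xs σ → xc + δ s c * (- (xs + xs) - σ) + δ t c * xs + δ s₁ c * (xs + σ))
                   (Hᵢ₊₁.flow-T Y c) (flow-at-s Y) (ΣF-flow Y))
     (trans (cycleIdentity (δ s c) (δ t c) (δ s₁ c) (y c) (y (next c)) (y (prev c)) (y s) (y t) (y s₁) (Q₁ Y) (Q₂ Y) (G-attach Y c)
                           (δ-localizes s c y) (δ-localizes t c y) (δ-localizes s₁ c y) (δ-disjoint s≢t c) (δ-idempotent s c))
            (sym (Hᵢ.flow-T-at (shift t s₁ Y) c refl refl refl
                    (cong (λ d → y (next c) + d * Δ) (δ-next c)) (cong (λ d → y (prev c) + d * Δ) (δ-prev c))
                    (moment-shift t s₁ f₁ Y) (moment-shift t s₁ f₂ Y) (G-attach-shift t s₁ Y c))))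
      where
      y : Fin n → ℤ
      y c = Y (T c)
      Δ = y t + y s₁ - (y s + y s)

    key-F : ∀ Y a → flow (μ (suc i)) Y (F a) ≡ flow (μ i) (shift t s₁ Y) (F a)
    key-F Y a = begin
      flow (μ (suc i)) Y (F a)
        ≡⟨ Hᵢ₊₁.flow-F Y a ⟩
      F-internal Y a + (+ f₁ a * (Y (F a) - Y (T s)) + + f₂ a * (Y (F a) - Y (T s₁)))
        ≡⟨ cong₂ _+_ (sym (F-internal-shift t s₁ Y a)) (reattach (+ f₁ a) (+ f₂ a) (Y (F a)) (Y (T t)) (Y (T s)) (Y (T s₁))) ⟩
      F-internal Z a + (+ f₁ a * (Z (F a) - Y (T t)) + + f₂ a * (Z (F a) - (Y (T t) + Y (T s₁) - Y (T s))))
        ≡⟨ cong₂ (λ zt zs → F-internal Z a + (+ f₁ a * (Z (F a) - zt) + + f₂ a * (Z (F a) - zs)))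
                 (sym (shift-away t s₁ Y t t≢s)) (sym (shift-at-s t s₁ Y)) ⟩
      F-internal Z a + (+ f₁ a * (Z (F a) - Z (T t)) + + f₂ a * (Z (F a) - Z (T s)))
        ≡⟨ sym (Hᵢ.flow-F Z a) ⟩
      flow (μ i) Z (F a) ∎
      where
      open ≡-Reasoning
      Z = shift t s₁ Y
      reattach : ∀ (w₁ w₂ ya yt ys ys₁ : ℤ) →
        w₁ * (ya - ys) + w₂ * (ya - ys₁) ≡ w₁ * ((ya + yt - ys) - yt) + w₂ * ((ya + yt - ys) - (yt + ys₁ - ys))
      reattach = solve-∀

    -- G sees neither F nor the pivot s, so its flow is unchanged.
    key-G : ∀ Y b → flow (μ (suc i)) Y (G b) ≡ flow (μ i) (shift t s₁ Y) (G b)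
    key-G Y b = cong₂ _+_
      (sum-cong-≗ (λ a → trans (ℤP.*-zeroˡ (Y (G b) - Y (F a))) (sym (ℤP.*-zeroˡ (Y (G b) - Z (F a))))))
      (cong₂ _+_ (begin
        sum (λ c → + (g₁ b ℕ.* ind (toℕ c) (suc k) ℕ.+ g₂ b ℕ.* ind (toℕ c) (suc (suc k))) * (Y (G b) - Y (T c)))
          ≡⟨ sum-two-points (g₁ b) (g₂ b) gAt₁ gAt₂ (suc k) (suc (suc k)) toℕ-gAt₁ toℕ-gAt₂ (λ c → Y (G b) - Y (T c)) ⟩
        + g₁ b * (Y (G b) - Y (T gAt₁)) + + g₂ b * (Y (G b) - Y (T gAt₂))
          ≡⟨ cong₂ (λ y₁ y₂ → + g₁ b * (Y (G b) - y₁) + + g₂ b * (Y (G b) - y₂))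
                   (sym (shift-away t s₁ Y gAt₁ gAt₁≢s)) (sym (shift-away t s₁ Y gAt₂ gAt₂≢s)) ⟩
        + g₁ b * (Y (G b) - Z (T gAt₁)) + + g₂ b * (Y (G b) - Z (T gAt₂))
          ≡⟨ sym (sum-two-points (g₁ b) (g₂ b) gAt₁ gAt₂ (suc k) (suc (suc k)) toℕ-gAt₁ toℕ-gAt₂ (λ c → Y (G b) - Z (T c))) ⟩
        sum (λ c → + (g₁ b ℕ.* ind (toℕ c) (suc k) ℕ.+ g₂ b ℕ.* ind (toℕ c) (suc (suc k))) * (Y (G b) - Z (T c))) ∎)
        refl)
      where
      open ≡-Reasoning
      Z = shift t s₁ Y

    key : ∀ Y → rowOp t s₁ (flow (μ (suc i)) Y) ≗ flow (μ i) (shift t s₁ Y)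
    key Y (inj₁ a)        = key-F Y a
    key Y (inj₂ (inj₁ c)) = key-T Y c
    key Y (inj₂ (inj₂ b)) = key-G Y b

    stepIso : LatticeIso (Span (flow (μ i))) (Span (flow (μ (suc i))))
    stepIso = spanIso rowOpIso (flow (μ i)) (flow (μ (suc i))) (shift s₁ t) (shift t s₁)
      (flow-cong (μ (suc i))) (shift-inverse s₁ t s₁≢s t≢s)
      (λ z v → trans (key (shift s₁ t z) v) (flow-cong (μ i) (shift-inverse t s₁ t≢s s₁≢s z) v))

  snfGroupIso : ∀ {N N′} {L D : Mat N} {L′ D′ : Mat N′} → IsSNF L D → IsSNF L′ D′ →
    LatticeIso (Span (L ▷_)) (Span (L′ ▷_)) → GroupIso (moduli D) (moduli D′)
  snfGroupIso {D = D} {D′ = D′} S S′ e =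
    cyclicIso (LatticeIso-resp (diagonalSpan⇒ D (IsSNF.diagonal S)) (diagonalSpan⇐ D (IsSNF.diagonal S))
                               (diagonalSpan⇒ D′ (IsSNF.diagonal S′)) (diagonalSpan⇐ D′ (IsSNF.diagonal S′))
                (LatticeIso-trans (snfIso S) (LatticeIso-trans e (LatticeIso-sym (snfIso S′)))))

  module _ (p q k : ℕ)
    (adjF : Fin p → Fin p → Bool) (adjF-sym : ∀ a b → adjF a b ≡ adjF b a)
    (adjG : Fin q → Fin q → Bool)
    (f₁ f₂ : Fin p → ℕ) (g₁ g₂ : Fin q → ℕ) where

    open Vertices p k q

    μ : ℕ → V → V → ℕ
    μ = multS k adjF adjG f₁ f₂ g₁ g₂

    fromH₀ : ∀ j → j ≤ suc k → LatticeIso (Span (flow (μ 0))) (Span (flow (μ j)))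
    fromH₀ zero    _           = LatticeIso-refl
    fromH₀ (suc j) (ℕ.s≤s j≤k) =
      LatticeIso-trans (fromH₀ j (ℕP.m≤n⇒m≤1+n j≤k)) (Step.stepIso p q k adjF adjF-sym adjG f₁ f₂ g₁ g₂ j j≤k)

    laplaciansIso : ∀ i j → i ≤ suc k → j ≤ suc k →
      LatticeIso (Span (laplacian (H k adjF adjG f₁ f₂ g₁ g₂ i) ▷_)) (Span (laplacian (H k adjF adjG f₁ f₂ g₁ g₂ j) ▷_))
    laplaciansIso i j i≤ j≤ =
      LatticeIso-trans (laplacianIso (μ i))
        (LatticeIso-trans (LatticeIso-sym (fromH₀ i i≤))
          (LatticeIso-trans (fromH₀ j j≤) (LatticeIso-sym (laplacianIso (μ j)))))

open import Defs
open import Data.Nat using (ℕ; suc; _≤_; _+_)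
open import Data.Fin using (Fin)
open import Data.Bool using (Bool; false)
open import Relation.Binary.PropositionalEquality using (_≡_)
open SandpileProof using (snfGroupIso; laplaciansIso)

theorem1 : (p q k : ℕ)
    (adjF : Fin p → Fin p → Bool) → (∀ a b → adjF a b ≡ adjF b a) → (∀ a → adjF a a ≡ false) →
    (adjG : Fin q → Fin q → Bool) → (∀ a b → adjG a b ≡ adjG b a) → (∀ a → adjG a a ≡ false) →
    (f₁ f₂ : Fin p → ℕ) (g₁ g₂ : Fin q → ℕ) →
    (i j : ℕ) → i ≤ suc k → j ≤ suc k →
    (Di Dj : Mat (p + ((3 + k) + q))) →
    IsSNF (laplacian (H k adjF adjG f₁ f₂ g₁ g₂ i)) Di →
    IsSNF (laplacian (H k adjF adjG f₁ f₂ g₁ g₂ j)) Dj →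
    GroupIso (moduli Di) (moduli Dj)
theorem1 p q k adjF adjF-sym _ adjG _ _ f₁ f₂ g₁ g₂ i j i≤ j≤ Di Dj Si Sj =
  snfGroupIso Si Sj (laplaciansIso p q k adjF adjF-sym adjG f₁ f₂ g₁ g₂ i j i≤ j≤)
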